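{- Let $1\le k<n$. The map $f_k(\lambda)=(\lambda^{(1)}_i+\lambda^{(2)}_i)_{1\le i\le k}$ is a bijection $f_k:\mathbb{Y}_{OG(k,2n+1)}\to P(n-k,n)$. Moreover, for every $w\in W^{OG(k,2n+1)}$ one has $f_k(\lambda(w))=\gamma(w)$, i.e. the Schubert variety indexed by $\lambda(w)$ equals the Schubert variety indexed by $f_k(\lambda(w))$.
   Context: Type $B_n$ positive roots in $\mathbb{R}^n$: $e_a-e_b$, $e_a+e_b$ ($1\le a<b\le n$) and $e_a$; simple roots $\beta_i=e_i-e_{i+1}$ ($i<n$), $\beta_n=e_n$; $\alpha\preceq\alpha'$ iff $\alpha'-\alpha$ is a nonnegative integer combination of simple roots. Let $\Lambda_k$ be the set of roots $e_a\pm e_c$ and $e_a$ with $a\le k<c$, together with $e_a+e_b$, $a<b\le k$. The base region is $\{e_a\pm e_c, e_a: a\le k<c\}$, the top region $\{e_a+e_b: a<b\le k\}$. For $1\le i\le k$, row $i$ of the base is $\{e_{k+1-i}\pm e_c: c>k\}\cup\{e_{k+1-i}\}$. For $S\subseteq\Lambda_k$ put $S^{(1)}_i=|S\cap\text{row } i|$ and $S^{(2)}_i=|\{a<k+1-i: e_a+e_{k+1-i}\in S\}|$. $W^{OG(k,2n+1)}$ is the set of signed permutations written in one-line notation as $w=(y_1,\dots,y_{k-r},\overline{z_r},\dots,\overline{z_1},v_1,\dots,v_{n-k})$, $0\le r\le k$, with $\{y_t\}\cup\{z_q\}\cup\{v_l\}=\{1,\dots,n\}$, $y_1<\dots<y_{k-r}$,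 $z_r>\dots>z_1$, $v_1<\dots<v_{n-k}$, bars denoting negative entries. $w$ acts on $\mathbb{R}^n$ by $w(e_a)=e_m$ if the $a$-th entry is $m$ and $w(e_a)=-e_m$ if it is $\overline m$. The RYD of $w$ is $\lambda(w)=\{\alpha>0: w(\alpha)<0\}$, and $\mathbb{Y}_{OG(k,2n+1)}=\{\lambda(w)\}$. These index the Schubert varieties of $OG(k,2n+1)$ (and of $LG(k,2n)$). $P(n-k,n)$ is the set of partitions $\gamma$ with at most $k$ parts, each $\le 2n-k$, that are $(n-k)$-strict ($\gamma_i>\gamma_{i+1}$ whenever $\gamma_i>n-k$); this is the Buch–Kresch–Tamvakis indexing set, under which the Schubert variety indexed by $w$ is indexed by $\gamma(w)$, where $\gamma(w)_i=(n-k)+(n+1-z_i)$ if $i\le r$ and $\gamma(w)_i=|\{l: y_{k+1-i}>v_l\}|$ if $i>r$. -}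

module Defs where

open import Data.Nat using (ℕ; zero; suc; _+_; _∸_; _*_; _≤_; _<_; _≡ᵇ_; _<?_)
open import Data.Integer as ℤ using (ℤ; +_; -[1+_]; 0ℤ; 1ℤ; -1ℤ) renaming (_+_ to _+ℤ_; _-_ to _-ℤ_; _*_ to _*ℤ_; -_ to -ℤ_)
open import Data.Fin using (Fin; toℕ) renaming (zero to fzero; suc to fsuc)
open import Data.Bool using (if_then_else_)
open import Data.List using (List; []; _∷_; map; _++_; length; reverse; filter; upTo)
open import Data.List.Relation.Unary.Linked using (Linked)
open import Data.List.Relation.Binary.Permutation.Propositional using (_↭_)
open import Data.Vec using (Vec; toList)
open import Data.Product using (Σ; _×_; ∃-syntax)
open import Relation.Binary.PropositionalEquality using (_≡_)
open import Relation.Nullary using (¬_)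
open import Function.Bundles using (_⇔_)

-- [a .. b] (empty if b < a)
fromTo : ℕ → ℕ → List ℕ
fromTo a b = map (λ t → a + t) (upTo (suc b ∸ a))

-- 1-indexed lookup with default
nth1 : {A : Set} → A → List A → ℕ → A
nth1 d []       _             = d
nth1 d (x ∷ xs) zero          = d
nth1 d (x ∷ xs) (suc zero)    = x
nth1 d (x ∷ xs) (suc (suc i)) = nth1 d xs (suc i)

data Count {A : Set} (P : A → Set) : List A → ℕ → Set where
  c[]  : Count P [] 0
  cyes : ∀ {x xs m} → P x → Count P xs m → Count P (x ∷ xs) (suc m)
  cno  : ∀ {x xs m} → ¬ P x → Count P xs m → Count P (x ∷ xs) m

sumFin : (n : ℕ) → (Fin n → ℤ) → ℤ
sumFin zero    f = 0ℤ
sumFin (suc n) f = f fzero +ℤ sumFin n (λ i → f (fsuc i))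

-- Vectors in ℝ^n (integral ones suffice: roots lie in ℤ^n), coordinates
-- indexed by Fin n; coordinate j ↔ e_{toℕ j + 1}.

Vect : ℕ → Set
Vect n = Fin n → ℤ

-- standard basis vector e_a (a is 1-indexed)
e : (n : ℕ) → ℕ → Vect n
e n a j = if (suc (toℕ j) ≡ᵇ a) then 1ℤ else 0ℤ

_⊕_ : ∀ {n} → Vect n → Vect n → Vect n
(x ⊕ y) j = x j +ℤ y j

_⊖_ : ∀ {n} → Vect n → Vect n → Vect n
(x ⊖ y) j = x j -ℤ y j

zeroV : ∀ {n} → Vect n
zeroV j = 0ℤ

-- simple roots β_i (i = toℕ i' + 1): e_i - e_{i+1} for i < n, β_n = e_n
β : (n : ℕ) → Fin n → Vect n
β n i = if (suc (toℕ i) ≡ᵇ n) then e n n else (e n (suc (toℕ i)) ⊖ e n (suc (suc (toℕ i))))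

comb : (n : ℕ) → (Fin n → ℕ) → Vect n
comb n c j = sumFin n (λ i → (+ c i) *ℤ β n i j)

_≼_ : ∀ {n} → Vect n → Vect n → Set
_≼_ {n} α α' = Σ (Fin n → ℕ) (λ c → ∀ j → (α' ⊖ α) j ≡ comb n c j)

_≺_ : ∀ {n} → Vect n → Vect n → Set
α ≺ α' = α ≼ α' × ¬ (∀ j → α j ≡ α' j)

data Root : Set where
  minus : ℕ → ℕ → Root
  plus  : ℕ → ℕ → Root
  short : ℕ → Root

vec : (n : ℕ) → Root → Vect n
vec n (minus a b) = e n a ⊖ e n b
vec n (plus a b)  = e n a ⊕ e n b
vec n (short a)   = e n a

IsPos : ℕ → Root → Set
IsPos n (minus a b) = 1 ≤ a × a < b × b ≤ n
IsPos n (plus a b)  = 1 ≤ a × a < b × b ≤ n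
IsPos n (short a)   = 1 ≤ a × a ≤ n

-- image of e_a under an entry t of the one-line notation: coordinate at position t'
coeff : ℤ → ℕ → ℤ
coeff (+ m)      t = if (t ≡ᵇ m) then 1ℤ else 0ℤ
coeff (-[1+ m ]) t = if (t ≡ᵇ suc m) then -1ℤ else 0ℤ

-- w(x) = Σ_a x_a w(e_a), w given in one-line notation (list of n signed entries)
act : (n : ℕ) → List ℤ → Vect n → Vect n
act n w x j = sumFin n (λ a → x a *ℤ coeff (nth1 0ℤ w (suc (toℕ a))) (suc (toℕ j)))

-- W^{OG(k,2n+1)}: w = (y_1..y_{k-r}, z̄_r..z̄_1, v_1..v_{n-k});
-- zs lists z_1,...,z_r (so z_1 < ... < z_r).
record WOG (k n : ℕ) : Set where
  field
    r  : ℕ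
    ys : List ℕ
    zs : List ℕ
    vs : List ℕ
    r≤k   : r ≤ k
    len-y : length ys ≡ k ∸ r
    len-z : length zs ≡ r
    len-v : length vs ≡ n ∸ k
    y-inc : Linked _<_ ys
    z-inc : Linked _<_ zs
    v-inc : Linked _<_ vs
    perm  : (ys ++ zs ++ vs) ↭ fromTo 1 n

oneLine : ∀ {k n} → WOG k n → List ℤ
oneLine w = map +_ (WOG.ys w) ++ map (λ z → -ℤ (+ z)) (reverse (WOG.zs w)) ++ map +_ (WOG.vs w)

Lam : ∀ {k n} → WOG k n → Root → Set
Lam {k} {n} w ρ = IsPos n ρ × (act n (oneLine w) (vec n ρ) ≺ zeroV)

row : ℕ → ℕ → ℕ → List Root
row k n i = map (minus (suc k ∸ i)) (fromTo (suc k) n)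
         ++ map (plus (suc k ∸ i)) (fromTo (suc k) n)
         ++ short (suc k ∸ i) ∷ []

topRow : ℕ → ℕ → List Root
topRow k i = map (λ a → plus a (suc k ∸ i)) (fromTo 1 (k ∸ i))

-- 1-indexed entry of a k-tuple (0 beyond the end)
at : ∀ {k} → Vec ℕ k → ℕ → ℕ
at γ i = nth1 0 (toList γ) i

-- f_k(S) = γ  (S^{(1)}_i + S^{(2)}_i = γ_i for 1 ≤ i ≤ k)
FK : (k n : ℕ) → (Root → Set) → Vec ℕ k → Set
FK k n S γ = ∀ i → 1 ≤ i → i ≤ k →
  ∃[ m₁ ] ∃[ m₂ ] (Count S (row k n i) m₁ × Count S (topRow k i) m₂ × at γ i ≡ m₁ + m₂)

-- P(n-k,n): partitions with ≤ k parts (as k-tuples padded by 0), parts ≤ 2n-k,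
-- (n-k)-strict
InP : (k n : ℕ) → Vec ℕ k → Set
InP k n γ =
    (∀ i → 1 ≤ i → i < k → at γ (suc i) ≤ at γ i)
  × (∀ i → 1 ≤ i → i ≤ k → at γ i ≤ (2 * n) ∸ k)
  × (∀ i → 1 ≤ i → i < k → n ∸ k < at γ i → at γ (suc i) < at γ i)

gammaOf : ∀ {k n} → WOG k n → Vec ℕ k
gammaOf {k} {n} w = Data.Vec.tabulate g
  where
  open WOG w
  g : Fin k → ℕ
  g i' with suc (toℕ i') Data.Nat.≤? r
  ... | Relation.Nullary.yes _ = (n ∸ k) + (suc n ∸ nth1 0 zs (suc (toℕ i')))
  ... | Relation.Nullary.no _  =
        length (filter (_<? nth1 0 ys (suc k ∸ suc (toℕ i'))) vs)

-- Everything is reduced to the explicit partition γ(w).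
--  * Root order: v < 0 iff the prefix sums of -v are nonnegative and v ≠ 0;
--    this decides negativity of ±e_p ± e_q and ±e_p, so whether a root lies
--    in λ(w) is read off from the signed entries of w at its positions.
--  * Counting row i of Λ_k with these criteria gives f_k(λ(w)) = γ(w)
--    (fk-gamma); a direct check gives γ(w) ∈ P(n-k, n) (gamma-in-P).
--  * γ(w) determines w: r counts the parts exceeding n-k, those parts give
--    the z's, and the others give the ranks of the y's among ys ++ vs
--    (Injectivity).
--  * Every γ ∈ P(n-k, n) is some γ(w): the z's are read off from the large
--    parts and the other values are distributed greedily (Construction).
-- Since FK is functional in γ, the four claims of the theorem follow.

module Submission where

open import Defs
open import Data.Nat using (ℕ; zero; suc; _+_; _∸_; _*_; _≤_; _<_; _≤?_; _<?_; z≤n; s≤s; pred; _≡ᵇ_; >-nonZero)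
import Data.Nat.Properties as ℕP
import Data.Nat.Tactic.RingSolver as ℕSolver
open import Data.Integer using (ℤ; +_; 0ℤ; 1ℤ)
  renaming (_+_ to _+ℤ_; _-_ to _-ℤ_; _*_ to _*ℤ_; -_ to negℤ)
import Data.Integer.Properties as ℤP
import Data.Integer.Tactic.RingSolver as ℤSolver
open import Data.Fin using (Fin; toℕ; fromℕ<) renaming (zero to fzero; suc to fsuc)
open import Data.Fin.Properties using (toℕ-fromℕ<; toℕ<n)
open import Data.Bool using (true; false; if_then_else_; T)
open import Data.Vec using (Vec; tabulate)
open import Data.List using (List; []; _∷_; map; _++_; length; reverse; filter; applyUpTo)
import Data.List.Properties as ListP
open import Data.List.Relation.Unary.All as All using (All; []; _∷_)
import Data.List.Relation.Unary.All.Properties as AllP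
open import Data.List.Relation.Unary.Any using (here; there)
open import Data.List.Membership.Propositional using (_∈_)
open import Data.List.Membership.Propositional.Properties using (∈-++⁺ˡ; ∈-++⁺ʳ)
open import Data.List.Membership.DecPropositional ℕP._≟_ using (_∈?_)
open import Data.List.Relation.Unary.Linked as Linked using (Linked; []; [-]; _∷_)
import Data.List.Relation.Unary.Linked.Properties as LinkedP
open import Data.List.Relation.Binary.Permutation.Propositional using (_↭_; prep; ↭-refl; ↭-sym; ↭-trans; ↭-reflexive)
import Data.List.Relation.Binary.Permutation.Propositional.Properties as PermP
open import Data.Product using (Σ; _×_; _,_; proj₁; proj₂; ∃-syntax)
open import Data.Sum using (_⊎_; inj₁; inj₂)
open import Data.Empty using (⊥; ⊥-elim)
open import Data.Unit using (⊤; tt)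
open import Relation.Binary using (tri<; tri≈; tri>)
open import Relation.Binary.PropositionalEquality
open import Relation.Nullary using (¬_; Dec; yes; no)
open import Relation.Unary using (Decidable)
open import Function using (_∘_)
open import Function.Bundles using (_⇔_; mk⇔; Equivalence)
open import Function.Construct.Composition using (_⇔-∘_)
open import Function.Construct.Symmetry using (⇔-sym)

-- The Kronecker delta: δ p t is the t-th coordinate (counted from 0) of
-- e_{p+1}.  By definition of e, e n (suc p) j reduces to δ p (toℕ j).
δ : ℕ → ℕ → ℤ
δ p t = if t ≡ᵇ p then 1ℤ else 0ℤ

δ-same : ∀ p → δ p p ≡ 1ℤ
δ-same zero    = refl
δ-same (suc p) = δ-same p

δ-diff : ∀ {p t} → t ≢ p → δ p t ≡ 0ℤ
δ-diff {zero}  {zero}  t≢p = ⊥-elim (t≢p refl)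
δ-diff {zero}  {suc t} _   = refl
δ-diff {suc p} {zero}  _   = refl
δ-diff {suc p} {suc t} t≢p = δ-diff {p} {t} (λ t≡p → t≢p (cong suc t≡p))

δ-<  : ∀ {p t} → t < p → δ p t ≡ 0ℤ
δ-< t<p = δ-diff (λ t≡p → ℕP.<-irrefl t≡p t<p)

δ-sym : ∀ p t → δ p t ≡ δ t p
δ-sym zero    zero    = refl
δ-sym zero    (suc t) = refl
δ-sym (suc p) zero    = refl
δ-sym (suc p) (suc t) = δ-sym p t

δ-01 : ∀ p t → δ p t ≡ 0ℤ ⊎ δ p t ≡ 1ℤ
δ-01 zero    zero    = inj₂ refl
δ-01 zero    (suc t) = inj₁ refl
δ-01 (suc p) zero    = inj₁ refl
δ-01 (suc p) (suc t) = δ-01 p t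

sumFin-cong : ∀ n {f g : Fin n → ℤ} → (∀ i → f i ≡ g i) → sumFin n f ≡ sumFin n g
sumFin-cong zero    f≗g = refl
sumFin-cong (suc n) f≗g = cong₂ _+ℤ_ (f≗g fzero) (sumFin-cong n (λ i → f≗g (fsuc i)))

sumFin-zero : ∀ n {f : Fin n → ℤ} → (∀ i → f i ≡ 0ℤ) → sumFin n f ≡ 0ℤ
sumFin-zero zero    f≗0 = refl
sumFin-zero (suc n) f≗0 rewrite f≗0 fzero | sumFin-zero n (λ i → f≗0 (fsuc i)) = refl

sum-of-sums : ∀ a b c d → (a +ℤ b) +ℤ (c +ℤ d) ≡ (a +ℤ c) +ℤ (b +ℤ d)
sum-of-sums = ℤSolver.solve-∀

sum-of-differences : ∀ a b c d → (a -ℤ b) +ℤ (c -ℤ d) ≡ (a +ℤ c) -ℤ (b +ℤ d)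
sum-of-differences = ℤSolver.solve-∀

*-distribˡ-- : ∀ a b c → a *ℤ (b -ℤ c) ≡ a *ℤ b -ℤ a *ℤ c
*-distribˡ-- = ℤSolver.solve-∀

*-distribʳ-- : ∀ a b c → (b -ℤ c) *ℤ a ≡ b *ℤ a -ℤ c *ℤ a
*-distribʳ-- = ℤSolver.solve-∀

sumFin-+ : ∀ n (f g : Fin n → ℤ) → sumFin n (λ i → f i +ℤ g i) ≡ sumFin n f +ℤ sumFin n g
sumFin-+ zero    f g = refl
sumFin-+ (suc n) f g rewrite sumFin-+ n (λ i → f (fsuc i)) (λ i → g (fsuc i)) =
  sum-of-sums (f fzero) (g fzero) (sumFin n (λ i → f (fsuc i))) (sumFin n (λ i → g (fsuc i)))

sumFin-- : ∀ n (f g : Fin n → ℤ) → sumFin n (λ i → f i -ℤ g i) ≡ sumFin n f -ℤ sumFin n g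
sumFin-- zero    f g = refl
sumFin-- (suc n) f g rewrite sumFin-- n (λ i → f (fsuc i)) (λ i → g (fsuc i)) =
  sum-of-differences (f fzero) (g fzero) (sumFin n (λ i → f (fsuc i))) (sumFin n (λ i → g (fsuc i)))

-- Coordinates addressed by a natural number (0 when out of range), and
-- the coordinate just before (0 at position 0).
coord : (n : ℕ) → (Fin n → ℤ) → ℕ → ℤ
coord zero    x m       = 0ℤ
coord (suc n) x zero    = x fzero
coord (suc n) x (suc m) = coord n (λ i → x (fsuc i)) m

prevCoord : (n : ℕ) → (Fin n → ℤ) → ℕ → ℤ
prevCoord n x zero    = 0ℤ
prevCoord n x (suc m) = coord n x m

coord-toℕ : ∀ n (F : ℕ → ℤ) m → m < n → coord n (λ i → F (toℕ i)) m ≡ F m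
coord-toℕ (suc n) F zero    _         = refl
coord-toℕ (suc n) F (suc m) (s≤s m<n) = coord-toℕ n (λ t → F (suc t)) m m<n

coord-nat : ∀ n (c : Fin n → ℕ) m → Σ ℕ (λ a → coord n (λ i → + c i) m ≡ + a)
coord-nat zero    c m       = 0 , refl
coord-nat (suc n) c zero    = c fzero , refl
coord-nat (suc n) c (suc m) = coord-nat n (λ i → c (fsuc i)) m

sum-δ : ∀ n (x : Fin n → ℤ) m → sumFin n (λ i → x i *ℤ δ (toℕ i) m) ≡ coord n x m
sum-δ zero    x m = refl
sum-δ (suc n) x zero
  rewrite sumFin-zero n {λ i → x (fsuc i) *ℤ 0ℤ} (λ i → ℤP.*-zeroʳ (x (fsuc i)))
  = trans (ℤP.+-identityʳ _) (ℤP.*-identityʳ _)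
sum-δ (suc n) x (suc m) rewrite ℤP.*-zeroʳ (x fzero) =
  trans (ℤP.+-identityˡ _) (sum-δ n (λ i → x (fsuc i)) m)

sum-δ-prev : ∀ n (x : Fin n → ℤ) m → sumFin n (λ i → x i *ℤ δ (suc (toℕ i)) m) ≡ prevCoord n x m
sum-δ-prev n x zero    = sumFin-zero n (λ i → ℤP.*-zeroʳ (x i))
sum-δ-prev n x (suc m) = sum-δ n x m

-- Coordinates of the simple roots: β_i = e_i - e_{i+1}, the second term
-- vanishing automatically for i = n.
β-coord : ∀ n (i j : Fin n) → β n i j ≡ δ (toℕ i) (toℕ j) -ℤ δ (suc (toℕ i)) (toℕ j)
β-coord n i j with suc (toℕ i) ≡ᵇ n in eq
... | false = refl
... | true  = begin
    e n n j                                        ≡⟨ cong (λ m → e n m j) (sym n≡) ⟩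
    δ (toℕ i) (toℕ j)                              ≡⟨ sym (ℤP.+-identityʳ _) ⟩
    δ (toℕ i) (toℕ j) -ℤ 0ℤ                        ≡⟨ cong (δ (toℕ i) (toℕ j) -ℤ_) (sym (δ-< j<si)) ⟩
    δ (toℕ i) (toℕ j) -ℤ δ (suc (toℕ i)) (toℕ j)   ∎
  where
  open ≡-Reasoning
  n≡ : suc (toℕ i) ≡ n
  n≡ = ℕP.≡ᵇ⇒≡ (suc (toℕ i)) n (subst T (sym eq) _)
  j<si : toℕ j < suc (toℕ i)
  j<si = subst (toℕ j <_) (sym n≡) (toℕ<n j)

comb-coord : ∀ n (c : Fin n → ℕ) (j : Fin n) →
  comb n c j ≡ coord n (λ i → + c i) (toℕ j) -ℤ prevCoord n (λ i → + c i) (toℕ j)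
comb-coord n c j = begin
  comb n c j                                                  ≡⟨ sumFin-cong n expand ⟩
  sumFin n (λ i → (+ c i) *ℤ δ (toℕ i) (toℕ j) -ℤ (+ c i) *ℤ δ (suc (toℕ i)) (toℕ j))
                                                              ≡⟨ sumFin-- n _ _ ⟩
  sumFin n (λ i → (+ c i) *ℤ δ (toℕ i) (toℕ j)) -ℤ sumFin n (λ i → (+ c i) *ℤ δ (suc (toℕ i)) (toℕ j))
                                                              ≡⟨ cong₂ _-ℤ_ (sum-δ n _ (toℕ j)) (sum-δ-prev n _ (toℕ j)) ⟩
  coord n (λ i → + c i) (toℕ j) -ℤ prevCoord n (λ i → + c i) (toℕ j) ∎
  where
  open ≡-Reasoning
  expand : ∀ i → (+ c i) *ℤ β n i j ≡ (+ c i) *ℤ δ (toℕ i) (toℕ j) -ℤ (+ c i) *ℤ δ (suc (toℕ i)) (toℕ j)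
  expand i = trans (cong ((+ c i) *ℤ_) (β-coord n i j)) (*-distribˡ-- (+ c i) _ _)

Negative : ∀ {n} → Vect n → Set
Negative v = v ≺ zeroV

prev : (ℕ → ℕ) → ℕ → ℤ
prev C zero    = 0ℤ
prev C (suc t) = + C t

-- Sufficient criterion: if -v_t = C_t - C_{t-1} for a sequence C of natural
-- numbers (the prefix sums of -v are nonnegative) and v ≠ 0, then v is negative.
negative-by-prefix-sums : ∀ n (v : Vect n) (u : ℕ → ℤ) → (∀ j → v j ≡ u (toℕ j)) →
  (C : ℕ → ℕ) → (∀ t → 0ℤ -ℤ u t ≡ + C t -ℤ prev C t) →
  ∀ t₀ → t₀ < n → u t₀ ≢ 0ℤ → Negative v
negative-by-prefix-sums n v u v≗u C -u≡ΔC t₀ t₀<n u≢0 =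
  (c , coords) , λ v≗0 → u≢0 (trans (sym (trans (v≗u j₀) (cong u (toℕ-fromℕ< t₀<n)))) (v≗0 j₀))
  where
  j₀ = fromℕ< t₀<n
  c : Fin n → ℕ
  c i = C (toℕ i)
  prevCoord-c : ∀ m → m < n → prevCoord n (λ i → + c i) m ≡ prev C m
  prevCoord-c zero    _      = refl
  prevCoord-c (suc t) st<n = coord-toℕ n (λ s → + C s) t (ℕP.<-trans (ℕP.n<1+n t) st<n)
  coords : ∀ j → (zeroV ⊖ v) j ≡ comb n c j
  coords j = trans (cong (0ℤ -ℤ_) (v≗u j)) (trans (-u≡ΔC (toℕ j)) (sym (trans (comb-coord n c j)
    (cong₂ _-ℤ_ (coord-toℕ n (λ s → + C s) (toℕ j) (toℕ<n j)) (prevCoord-c (toℕ j) (toℕ<n j))))))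

leading-positive-not-negative : ∀ n (v : Vect n) (u : ℕ → ℤ) → (∀ j → v j ≡ u (toℕ j)) →
  ∀ m → m < n → (∀ t → t < m → u t ≡ 0ℤ) → ∀ a → u m ≡ + suc a → ¬ Negative v
leading-positive-not-negative n v u v≗u m m<n u≡0 a um ((c , eq) , _) = contradiction-at-m
  where
  x : Fin n → ℤ
  x i = + c i
  coords : ∀ t → t < n → 0ℤ -ℤ u t ≡ coord n x t -ℤ prevCoord n x t
  coords t t<n = subst (λ s → 0ℤ -ℤ u s ≡ coord n x s -ℤ prevCoord n x s) (toℕ-fromℕ< t<n)
    (trans (cong (0ℤ -ℤ_) (sym (v≗u (fromℕ< t<n)))) (trans (eq (fromℕ< t<n)) (comb-coord n c (fromℕ< t<n))))
  coord-0 : ∀ t → t < m → coord n x t ≡ 0ℤ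
  prevCoord-0 : ∀ t → t ≤ m → prevCoord n x t ≡ 0ℤ
  coord-0 t t<m = begin
    coord n x t                             ≡⟨ sym (ℤP.+-identityʳ _) ⟩
    coord n x t -ℤ 0ℤ                       ≡⟨ cong (coord n x t -ℤ_) (sym (prevCoord-0 t (ℕP.<⇒≤ t<m))) ⟩
    coord n x t -ℤ prevCoord n x t          ≡⟨ sym (coords t (ℕP.<-trans t<m m<n)) ⟩
    0ℤ -ℤ u t                               ≡⟨ cong (0ℤ -ℤ_) (u≡0 t t<m) ⟩
    0ℤ                                      ∎
    where open ≡-Reasoning
  prevCoord-0 zero    _     = refl
  prevCoord-0 (suc t) t<m = coord-0 t t<m
  contradiction-at-m : ⊥
  contradiction-at-m with coord-nat n c m
  ... | b , coord≡b with trans (trans (cong (0ℤ -ℤ_) (sym um)) (coords m m<n))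
                              (trans (cong (coord n x m -ℤ_) (prevCoord-0 m ℕP.≤-refl)) (trans (ℤP.+-identityʳ _) coord≡b))
  ... | ()

-- The indicator H p t = [p ≤ t]; its differences are the deltas.
H : ℕ → ℕ → ℕ
H zero    t       = 1
H (suc p) zero    = 0
H (suc p) (suc t) = H p t

prev-H : ∀ p s → prev (H p) s ≡ + H (suc p) s
prev-H p zero    = refl
prev-H p (suc s) = refl

δ-ΔH : ∀ p t → δ p t ≡ + H p t -ℤ prev (H p) t
δ-ΔH zero    zero    = refl
δ-ΔH zero    (suc t) = refl
δ-ΔH (suc p) zero    = refl
δ-ΔH (suc p) (suc t) = trans (δ-ΔH p t) (cong (λ z → + H p t -ℤ z) (prev-H p t))

H-antitone : ∀ q p t → q ≤ p → H p t ≤ H q t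
H-antitone zero    zero    t       _         = ℕP.≤-refl
H-antitone zero    (suc p) zero    _         = z≤n
H-antitone zero    (suc p) (suc t) _         = H-antitone zero p t z≤n
H-antitone (suc q) (suc p) zero    _         = z≤n
H-antitone (suc q) (suc p) (suc t) (s≤s q≤p) = H-antitone q p t q≤p

prev-+ : ∀ A B t → prev (λ s → A s + B s) t ≡ prev A t +ℤ prev B t
prev-+ A B zero    = refl
prev-+ A B (suc t) = ℤP.pos-+ (A t) (B t)

pos-∸ : ∀ a b → b ≤ a → + (a ∸ b) ≡ + a -ℤ + b
pos-∸ a b b≤a = sym (trans (ℤP.[+m]-[+n]≡m⊖n a b) (ℤP.⊖-≥ b≤a))

prev-∸ : ∀ A B t → (∀ s → B s ≤ A s) → prev (λ s → A s ∸ B s) t ≡ prev A t -ℤ prev B t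
prev-∸ A B zero    B≤A = refl
prev-∸ A B (suc t) B≤A = pos-∸ (A t) (B t) (B≤A t)

neg-of-neg-sum : ∀ a b → 0ℤ -ℤ (negℤ a -ℤ b) ≡ a +ℤ b
neg-of-neg-sum = ℤSolver.solve-∀

neg-of-neg : ∀ a → 0ℤ -ℤ negℤ a ≡ a
neg-of-neg = ℤSolver.solve-∀

neg-of-difference : ∀ a b → 0ℤ -ℤ (a -ℤ b) ≡ b -ℤ a
neg-of-difference = ℤSolver.solve-∀

difference-of-differences : ∀ a b c d → (a -ℤ c) -ℤ (b -ℤ d) ≡ (a -ℤ b) -ℤ (c -ℤ d)
difference-of-differences = ℤSolver.solve-∀

neg-sum-negative : ∀ n p q → p < n → (v : Vect n) →
  (∀ j → v j ≡ negℤ (δ p (toℕ j)) -ℤ δ q (toℕ j)) → Negative v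
neg-sum-negative n p q p<n v v≗ =
  negative-by-prefix-sums n v (λ t → negℤ (δ p t) -ℤ δ q t) v≗ (λ s → H p s + H q s) ΔC p p<n nonzero
  where
  ΔC : ∀ t → 0ℤ -ℤ (negℤ (δ p t) -ℤ δ q t) ≡ + (H p t + H q t) -ℤ prev (λ s → H p s + H q s) t
  ΔC t = begin
    0ℤ -ℤ (negℤ (δ p t) -ℤ δ q t)                               ≡⟨ neg-of-neg-sum (δ p t) (δ q t) ⟩
    δ p t +ℤ δ q t                                              ≡⟨ cong₂ _+ℤ_ (δ-ΔH p t) (δ-ΔH q t) ⟩
    (+ H p t -ℤ prev (H p) t) +ℤ (+ H q t -ℤ prev (H q) t)      ≡⟨ sum-of-differences (+ H p t) (prev (H p) t) (+ H q t) (prev (H q) t) ⟩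
    (+ H p t +ℤ + H q t) -ℤ (prev (H p) t +ℤ prev (H q) t)      ≡⟨ cong₂ _-ℤ_ (sym (ℤP.pos-+ (H p t) (H q t)))
                                                                            (sym (prev-+ (H p) (H q) t)) ⟩
    + (H p t + H q t) -ℤ prev (λ s → H p s + H q s) t           ∎
    where open ≡-Reasoning
  nonzero : negℤ (δ p p) -ℤ δ q p ≢ 0ℤ
  nonzero eq rewrite δ-same p with δ-01 q p
  ... | inj₁ δ≡0 rewrite δ≡0 with eq
  ...   | ()
  nonzero eq | inj₂ δ≡1 rewrite δ≡1 with eq
  ...   | ()

neg-unit-negative : ∀ n p → p < n → (v : Vect n) → (∀ j → v j ≡ negℤ (δ p (toℕ j))) → Negative v
neg-unit-negative n p p<n v v≗ =
  negative-by-prefix-sums n v (λ t → negℤ (δ p t)) v≗ (H p) (λ t → trans (neg-of-neg (δ p t)) (δ-ΔH p t)) p p<n nonzero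
  where
  nonzero : negℤ (δ p p) ≢ 0ℤ
  nonzero eq rewrite δ-same p with eq
  ... | ()

difference-negative : ∀ n p q → q < p → p < n → (v : Vect n) →
  (∀ j → v j ≡ δ p (toℕ j) -ℤ δ q (toℕ j)) → Negative v
difference-negative n p q q<p p<n v v≗ =
  negative-by-prefix-sums n v (λ t → δ p t -ℤ δ q t) v≗ (λ s → H q s ∸ H p s) ΔC q (ℕP.<-trans q<p p<n) nonzero
  where
  Hp≤Hq : ∀ s → H p s ≤ H q s
  Hp≤Hq s = H-antitone q p s (ℕP.<⇒≤ q<p)
  ΔC : ∀ t → 0ℤ -ℤ (δ p t -ℤ δ q t) ≡ + (H q t ∸ H p t) -ℤ prev (λ s → H q s ∸ H p s) t
  ΔC t = begin
    0ℤ -ℤ (δ p t -ℤ δ q t)                                      ≡⟨ neg-of-difference (δ p t) (δ q t) ⟩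
    δ q t -ℤ δ p t                                              ≡⟨ cong₂ _-ℤ_ (δ-ΔH q t) (δ-ΔH p t) ⟩
    (+ H q t -ℤ prev (H q) t) -ℤ (+ H p t -ℤ prev (H p) t)      ≡⟨ difference-of-differences (+ H q t) (+ H p t) (prev (H q) t) (prev (H p) t) ⟩
    (+ H q t -ℤ + H p t) -ℤ (prev (H q) t -ℤ prev (H p) t)      ≡⟨ cong₂ _-ℤ_ (sym (pos-∸ (H q t) (H p t) (Hp≤Hq t)))
                                                                            (sym (prev-∸ (H q) (H p) t Hp≤Hq)) ⟩
    + (H q t ∸ H p t) -ℤ prev (λ s → H q s ∸ H p s) t           ∎
    where open ≡-Reasoning
  nonzero : δ p q -ℤ δ q q ≢ 0ℤ
  nonzero eq rewrite δ-same q | δ-< {p} {q} q<p with eq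
  ... | ()

difference-not-negative : ∀ n p q → p ≤ q → p < n → (v : Vect n) →
  (∀ j → v j ≡ δ p (toℕ j) -ℤ δ q (toℕ j)) → ¬ Negative v
difference-not-negative n p q p≤q p<n v v≗ neg with ℕP.m≤n⇒m<n∨m≡n p≤q
... | inj₂ refl = proj₂ neg (λ j → trans (v≗ j) (ℤP.+-inverseʳ (δ p (toℕ j))))
... | inj₁ p<q  =
  leading-positive-not-negative n v (λ t → δ p t -ℤ δ q t) v≗ p p<n vanish 0 leading neg
  where
  vanish : ∀ t → t < p → δ p t -ℤ δ q t ≡ 0ℤ
  vanish t t<p rewrite δ-< t<p | δ-< (ℕP.<-trans t<p p<q) = refl
  leading : δ p p -ℤ δ q p ≡ + 1
  leading rewrite δ-same p | δ-< p<q = refl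

sum-not-negative : ∀ n p q → p < n → q < n → (v : Vect n) →
  (∀ j → v j ≡ δ p (toℕ j) +ℤ δ q (toℕ j)) → ¬ Negative v
sum-not-negative n p q p<n q<n v v≗ with ℕP.<-cmp p q
... | tri< p<q _ _ = leading-positive-not-negative n v _ v≗ p p<n vanish 0 leading
  where
  vanish : ∀ t → t < p → δ p t +ℤ δ q t ≡ 0ℤ
  vanish t t<p rewrite δ-< t<p | δ-< (ℕP.<-trans t<p p<q) = refl
  leading : δ p p +ℤ δ q p ≡ + 1
  leading rewrite δ-same p | δ-< p<q = refl
... | tri≈ _ refl _ = leading-positive-not-negative n v _ v≗ p p<n vanish 1 leading
  where
  vanish : ∀ t → t < p → δ p t +ℤ δ p t ≡ 0ℤ
  vanish t t<p rewrite δ-< t<p = refl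
  leading : δ p p +ℤ δ p p ≡ + 2
  leading rewrite δ-same p = refl
... | tri> _ _ q<p = leading-positive-not-negative n v _ v≗ q q<n vanish 0 leading
  where
  vanish : ∀ t → t < q → δ p t +ℤ δ q t ≡ 0ℤ
  vanish t t<q rewrite δ-< t<q | δ-< (ℕP.<-trans t<q q<p) = refl
  leading : δ p q +ℤ δ q q ≡ + 1
  leading rewrite δ-same q | δ-< q<p = refl

unit-not-negative : ∀ n p → p < n → (v : Vect n) → (∀ j → v j ≡ δ p (toℕ j)) → ¬ Negative v
unit-not-negative n p p<n v v≗ = leading-positive-not-negative n v (δ p) v≗ p p<n (λ t → δ-<) 0 (δ-same p)

difference-criterion : ∀ n p q → p < n → q < n → (v : Vect n) →
  (∀ j → v j ≡ δ p (toℕ j) -ℤ δ q (toℕ j)) → Negative v ⇔ q < p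
difference-criterion n p q p<n q<n v v≗ = mk⇔ to (λ q<p → difference-negative n p q q<p p<n v v≗)
  where
  to : Negative v → q < p
  to neg with q <? p
  ... | yes q<p = q<p
  ... | no  q≮p = ⊥-elim (difference-not-negative n p q (ℕP.≮⇒≥ q≮p) p<n v v≗ neg)

act-⊖ : ∀ n ol (x y : Vect n) j → act n ol (x ⊖ y) j ≡ act n ol x j -ℤ act n ol y j
act-⊖ n ol x y j = trans (sumFin-cong n (λ a → *-distribʳ-- _ (x a) (y a))) (sumFin-- n _ _)

act-⊕ : ∀ n ol (x y : Vect n) j → act n ol (x ⊕ y) j ≡ act n ol x j +ℤ act n ol y j
act-⊕ n ol x y j = trans (sumFin-cong n (λ a → ℤP.*-distribʳ-+ _ (x a) (y a))) (sumFin-+ n _ _)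

act-e : ∀ n ol a j → a < n → act n ol (e n (suc a)) j ≡ coeff (nth1 0ℤ ol (suc a)) (suc (toℕ j))
act-e n ol a j a<n = begin
  act n ol (e n (suc a)) j                            ≡⟨ sumFin-cong n (λ i → trans (ℤP.*-comm (δ a (toℕ i)) (K i))
                                                                                  (cong (K i *ℤ_) (δ-sym a (toℕ i)))) ⟩
  sumFin n (λ i → K i *ℤ δ (toℕ i) a)                 ≡⟨ sum-δ n K a ⟩
  coord n K a                                         ≡⟨ coord-toℕ n (λ s → coeff (nth1 0ℤ ol (suc s)) (suc (toℕ j))) a a<n ⟩
  coeff (nth1 0ℤ ol (suc a)) (suc (toℕ j))            ∎
  where
  open ≡-Reasoning
  K : Fin n → ℤ
  K i = coeff (nth1 0ℤ ol (suc (toℕ i))) (suc (toℕ j))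

-- A nonzero signed entry: pos p stands for p+1 and neg p for -(p+1).
data Signed : Set where
  pos neg : ℕ → Signed

entry : Signed → ℤ
entry (pos p) = + suc p
entry (neg p) = negℤ (+ suc p)

magnitude : Signed → ℕ
magnitude (pos p) = p
magnitude (neg p) = p

image : Signed → ℕ → ℤ
image (pos p) t = δ p t
image (neg p) t = negℤ (δ p t)

coeff-entry : ∀ s t → coeff (entry s) (suc t) ≡ image s t
coeff-entry (pos p) t = refl
coeff-entry (neg p) t with t ≡ᵇ p
... | true  = refl
... | false = refl

act-basis : ∀ n ol a s → a < n → nth1 0ℤ ol (suc a) ≡ entry s → ∀ j → act n ol (e n (suc a)) j ≡ image s (toℕ j)
act-basis n ol a s a<n entry≡ j =
  trans (act-e n ol a j a<n) (trans (cong (λ t → coeff t (suc (toℕ j))) entry≡) (coeff-entry s (toℕ j)))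

-- When is w(α) < 0, in terms of the entries of w at the positions of α:
-- for e_a - e_b, for e_a + e_b, and for e_a.
InvMinus : Signed → Signed → Set
InvMinus (pos p) (pos q) = q < p
InvMinus (pos p) (neg q) = ⊥
InvMinus (neg p) (pos q) = ⊤
InvMinus (neg p) (neg q) = p < q

InvPlus : Signed → Signed → Set
InvPlus (pos p) (pos q) = ⊥
InvPlus (pos p) (neg q) = q < p
InvPlus (neg p) (pos q) = p < q
InvPlus (neg p) (neg q) = ⊤

InvShort : Signed → Set
InvShort (pos p) = ⊥
InvShort (neg p) = ⊤

sub-neg : ∀ a b → a -ℤ negℤ b ≡ a +ℤ b
sub-neg = ℤSolver.solve-∀

neg-sub-neg : ∀ a b → negℤ a -ℤ negℤ b ≡ b -ℤ a
neg-sub-neg = ℤSolver.solve-∀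

add-neg : ∀ a b → a +ℤ negℤ b ≡ a -ℤ b
add-neg = ℤSolver.solve-∀

neg-add : ∀ a b → negℤ a +ℤ b ≡ b -ℤ a
neg-add = ℤSolver.solve-∀

neg-add-neg : ∀ a b → negℤ a +ℤ negℤ b ≡ negℤ a -ℤ b
neg-add-neg = ℤSolver.solve-∀

minus-criterion : ∀ n sa sb → magnitude sa < n → magnitude sb < n → (v : Vect n) →
  (∀ j → v j ≡ image sa (toℕ j) -ℤ image sb (toℕ j)) → Negative v ⇔ InvMinus sa sb
minus-criterion n (pos p) (pos q) p<n q<n v v≗ = difference-criterion n p q p<n q<n v v≗
minus-criterion n (pos p) (neg q) p<n q<n v v≗ =
  mk⇔ (sum-not-negative n p q p<n q<n v (λ j → trans (v≗ j) (sub-neg (δ p (toℕ j)) (δ q (toℕ j))))) λ ()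
minus-criterion n (neg p) (pos q) p<n q<n v v≗ = mk⇔ (λ _ → tt) (λ _ → neg-sum-negative n p q p<n v v≗)
minus-criterion n (neg p) (neg q) p<n q<n v v≗ =
  difference-criterion n q p q<n p<n v (λ j → trans (v≗ j) (neg-sub-neg (δ p (toℕ j)) (δ q (toℕ j))))

plus-criterion : ∀ n sa sb → magnitude sa < n → magnitude sb < n → (v : Vect n) →
  (∀ j → v j ≡ image sa (toℕ j) +ℤ image sb (toℕ j)) → Negative v ⇔ InvPlus sa sb
plus-criterion n (pos p) (pos q) p<n q<n v v≗ = mk⇔ (sum-not-negative n p q p<n q<n v v≗) λ ()
plus-criterion n (pos p) (neg q) p<n q<n v v≗ =
  difference-criterion n p q p<n q<n v (λ j → trans (v≗ j) (add-neg (δ p (toℕ j)) (δ q (toℕ j))))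
plus-criterion n (neg p) (pos q) p<n q<n v v≗ =
  difference-criterion n q p q<n p<n v (λ j → trans (v≗ j) (neg-add (δ p (toℕ j)) (δ q (toℕ j))))
plus-criterion n (neg p) (neg q) p<n q<n v v≗ =
  mk⇔ (λ _ → tt) (λ _ → neg-sum-negative n p q p<n v (λ j → trans (v≗ j) (neg-add-neg (δ p (toℕ j)) (δ q (toℕ j)))))

short-criterion : ∀ n s → magnitude s < n → (v : Vect n) →
  (∀ j → v j ≡ image s (toℕ j)) → Negative v ⇔ InvShort s
short-criterion n (pos p) p<n v v≗ = mk⇔ (unit-not-negative n p p<n v v≗) λ ()
short-criterion n (neg p) p<n v v≗ = mk⇔ (λ _ → tt) (λ _ → neg-unit-negative n p p<n v v≗)

module _ {k n : ℕ} (w : WOG k n) where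

  private
    ol = oneLine w

  Lam-minus : ∀ a b sa sb → IsPos n (minus a b) → nth1 0ℤ ol a ≡ entry sa → nth1 0ℤ ol b ≡ entry sb →
    magnitude sa < n → magnitude sb < n → Lam w (minus a b) ⇔ InvMinus sa sb
  Lam-minus (suc a) (suc b) sa sb isPos@(_ , a<b , b≤n) ea eb sa<n sb<n =
    mk⇔ (λ lam → Equivalence.to crit (proj₂ lam)) (λ inv → isPos , Equivalence.from crit inv)
    where
    a<n = ℕP.<-≤-trans (ℕP.<-trans (ℕP.n<1+n a) a<b) b≤n
    crit = minus-criterion n sa sb sa<n sb<n _ (λ j →
      trans (act-⊖ n ol (e n (suc a)) (e n (suc b)) j) (cong₂ _-ℤ_ (act-basis n ol a sa a<n ea j) (act-basis n ol b sb b≤n eb j)))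

  Lam-plus : ∀ a b sa sb → IsPos n (plus a b) → nth1 0ℤ ol a ≡ entry sa → nth1 0ℤ ol b ≡ entry sb →
    magnitude sa < n → magnitude sb < n → Lam w (plus a b) ⇔ InvPlus sa sb
  Lam-plus (suc a) (suc b) sa sb isPos@(_ , a<b , b≤n) ea eb sa<n sb<n =
    mk⇔ (λ lam → Equivalence.to crit (proj₂ lam)) (λ inv → isPos , Equivalence.from crit inv)
    where
    a<n = ℕP.<-≤-trans (ℕP.<-trans (ℕP.n<1+n a) a<b) b≤n
    crit = plus-criterion n sa sb sa<n sb<n _ (λ j →
      trans (act-⊕ n ol (e n (suc a)) (e n (suc b)) j) (cong₂ _+ℤ_ (act-basis n ol a sa a<n ea j) (act-basis n ol b sb b≤n eb j)))

  Lam-short : ∀ a s → IsPos n (short a) → nth1 0ℤ ol a ≡ entry s → magnitude s < n → Lam w (short a) ⇔ InvShort s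
  Lam-short (suc a) s isPos@(_ , a≤n) ea s<n =
    mk⇔ (λ lam → Equivalence.to crit (proj₂ lam)) (λ inv → isPos , Equivalence.from crit inv)
    where
    crit = short-criterion n s s<n _ (act-basis n ol a s a≤n ea)

interval : ℕ → ℕ → List ℕ
interval a zero    = []
interval a (suc l) = a ∷ interval (suc a) l

applyUpTo-interval : ∀ (f : ℕ → ℕ) a l → (∀ t → f t ≡ a + t) → applyUpTo f l ≡ interval a l
applyUpTo-interval f a zero    f≗ = refl
applyUpTo-interval f a (suc l) f≗ = cong₂ _∷_ (trans (f≗ 0) (ℕP.+-identityʳ a))
  (applyUpTo-interval (f ∘ suc) (suc a) l (λ t → trans (f≗ (suc t)) (ℕP.+-suc a t)))

fromTo-interval : ∀ a b → fromTo a b ≡ interval a (suc b ∸ a)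
fromTo-interval a b =
  trans (ListP.map-applyUpTo (λ x → x) (λ t → a + t) (suc b ∸ a)) (applyUpTo-interval (λ t → a + t) a (suc b ∸ a) (λ t → refl))

interval-++ : ∀ a l₁ l₂ → interval a (l₁ + l₂) ≡ interval a l₁ ++ interval (a + l₁) l₂
interval-++ a zero     l₂ = cong (λ s → interval s l₂) (sym (ℕP.+-identityʳ a))
interval-++ a (suc l₁) l₂ = cong (a ∷_) (trans (interval-++ (suc a) l₁ l₂)
  (cong (λ s → interval (suc a) l₁ ++ interval s l₂) (sym (ℕP.+-suc a l₁))))

length-interval : ∀ a l → length (interval a l) ≡ l
length-interval a zero    = refl
length-interval a (suc l) = cong suc (length-interval (suc a) l)

∈-interval : ∀ {x} a l → x ∈ interval a l ⇔ (a ≤ x × x < a + l)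
∈-interval {x} a l = mk⇔ (to a l) (λ (a≤x , x<a+l) → from a l a≤x x<a+l)
  where
  to : ∀ a l → x ∈ interval a l → a ≤ x × x < a + l
  to a (suc l) (here refl) = ℕP.≤-refl , ℕP.m<m+n a (s≤s z≤n)
  to a (suc l) (there x∈) with to (suc a) l x∈
  ... | a<x , x<sa+l = ℕP.<⇒≤ a<x , subst (x <_) (sym (ℕP.+-suc a l)) x<sa+l
  from : ∀ a l → a ≤ x → x < a + l → x ∈ interval a l
  from a zero    a≤x x<a = ⊥-elim (ℕP.<-irrefl refl (ℕP.<-≤-trans x<a (subst (_≤ x) (sym (ℕP.+-identityʳ a)) a≤x)))
  from a (suc l) a≤x x<a+l with a ℕP.≟ x
  ... | yes refl = here refl
  ... | no  a≢x  = there (from (suc a) l (ℕP.≤∧≢⇒< a≤x a≢x) (subst (x <_) (ℕP.+-suc a l) x<a+l))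

All-interval : ∀ {P : ℕ → Set} a l → (∀ x → a ≤ x → x < a + l → P x) → All P (interval a l)
All-interval a zero    P-in = []
All-interval a (suc l) P-in = P-in a ℕP.≤-refl (ℕP.m<m+n a (s≤s z≤n))
  ∷ All-interval (suc a) l (λ x a<x x<sa+l → P-in x (ℕP.<⇒≤ a<x) (subst (x <_) (sym (ℕP.+-suc a l)) x<sa+l))

map-interval-suc : ∀ {B : Set} (f : ℕ → B) s l → map f (interval (suc s) l) ≡ map (λ t → f (suc t)) (interval s l)
map-interval-suc f s zero    = refl
map-interval-suc f s (suc l) = cong (f (suc s) ∷_) (map-interval-suc f (suc s) l)

interval-+ : ∀ a s l → interval (a + s) l ≡ map (λ t → a + t) (interval s l)
interval-+ a s zero    = refl
interval-+ a s (suc l) =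
  cong (a + s ∷_) (trans (cong (λ q → interval q l) (sym (ℕP.+-suc a s))) (interval-+ a (suc s) l))

interval-after : ∀ k l → interval (suc k) l ≡ map (λ t → k + suc t) (interval 0 l)
interval-after k l =
  trans (cong (λ q → interval q l) (ℕP.+-comm 1 k)) (trans (interval-+ k 1 l) (map-interval-suc (λ t → k + t) 0 l))

nth1-interval : ∀ a l t → t < l → nth1 0 (interval a l) (suc t) ≡ a + t
nth1-interval a (suc l) zero    _         = sym (ℕP.+-identityʳ a)
nth1-interval a (suc l) (suc t) (s≤s t<l) = trans (nth1-interval (suc a) l t t<l) (sym (ℕP.+-suc a t))

tabulate-nth1 : ∀ {A : Set} (d : A) xs → map (λ t → nth1 d xs (suc t)) (interval 0 (length xs)) ≡ xs
tabulate-nth1 d []       = refl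
tabulate-nth1 d (x ∷ xs) =
  cong (x ∷_) (trans (map-interval-suc (λ t → nth1 d (x ∷ xs) (suc t)) 0 (length xs)) (tabulate-nth1 d xs))

nth1-cons : ∀ {A : Set} (d x : A) xs m → 1 ≤ m → nth1 d (x ∷ xs) (suc m) ≡ nth1 d xs m
nth1-cons d x xs (suc m) _ = refl

nth1-map : ∀ {A B : Set} (f : A → B) d xs i → nth1 (f d) (map f xs) i ≡ f (nth1 d xs i)
nth1-map f d []       i             = refl
nth1-map f d (x ∷ xs) zero          = refl
nth1-map f d (x ∷ xs) (suc zero)    = refl
nth1-map f d (x ∷ xs) (suc (suc i)) = nth1-map f d xs (suc i)

nth1-map-within : ∀ (f : ℕ → ℕ) xs i → 1 ≤ i → i ≤ length xs → nth1 0 (map f xs) i ≡ f (nth1 0 xs i)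
nth1-map-within f (x ∷ xs) (suc zero)    _ _         = refl
nth1-map-within f (x ∷ xs) (suc (suc i)) _ (s≤s i≤) = nth1-map-within f xs (suc i) (s≤s z≤n) i≤

nth1-++ˡ : ∀ {A : Set} (d : A) xs ys a → 1 ≤ a → a ≤ length xs → nth1 d (xs ++ ys) a ≡ nth1 d xs a
nth1-++ˡ d (x ∷ xs) ys (suc zero)    _ _         = refl
nth1-++ˡ d (x ∷ xs) ys (suc (suc a)) _ (s≤s a≤) = nth1-++ˡ d xs ys (suc a) (s≤s z≤n) a≤

nth1-++ʳ : ∀ {A : Set} (d : A) xs ys m → 1 ≤ m → nth1 d (xs ++ ys) (length xs + m) ≡ nth1 d ys m
nth1-++ʳ d []       ys m 1≤m = refl
nth1-++ʳ d (x ∷ xs) ys m 1≤m =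
  trans (nth1-cons d x (xs ++ ys) (length xs + m) (ℕP.≤-trans 1≤m (ℕP.m≤n+m m (length xs)))) (nth1-++ʳ d xs ys m 1≤m)

nth1-reverse : ∀ {A : Set} (d : A) xs i → 1 ≤ i → i ≤ length xs → nth1 d (reverse xs) (suc (length xs ∸ i)) ≡ nth1 d xs i
nth1-reverse d (x ∷ xs) (suc zero) _ _ = begin
  nth1 d (reverse (x ∷ xs)) (suc (length xs))                 ≡⟨ cong₂ (λ ys l → nth1 d ys (suc l)) (ListP.unfold-reverse x xs)
                                                                                                     (sym (ListP.length-reverse xs)) ⟩
  nth1 d (reverse xs ++ x ∷ []) (suc (length (reverse xs)))   ≡⟨ cong (nth1 d (reverse xs ++ x ∷ [])) (ℕP.+-comm 1 _) ⟩
  nth1 d (reverse xs ++ x ∷ []) (length (reverse xs) + 1)     ≡⟨ nth1-++ʳ d (reverse xs) (x ∷ []) 1 ℕP.≤-refl ⟩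
  x                                                           ∎
  where open ≡-Reasoning
nth1-reverse d (x ∷ xs) (suc (suc i)) _ (s≤s i<) = begin
  nth1 d (reverse (x ∷ xs)) (suc (length xs ∸ suc i))          ≡⟨ cong (λ ys → nth1 d ys (suc (length xs ∸ suc i))) (ListP.unfold-reverse x xs) ⟩
  nth1 d (reverse xs ++ x ∷ []) (suc (length xs ∸ suc i))      ≡⟨ nth1-++ˡ d (reverse xs) (x ∷ []) _ (s≤s z≤n) in-range ⟩
  nth1 d (reverse xs) (suc (length xs ∸ suc i))                ≡⟨ nth1-reverse d xs (suc i) (s≤s z≤n) i< ⟩
  nth1 d xs (suc i)                                            ∎
  where
  open ≡-Reasoning
  in-range : suc (length xs ∸ suc i) ≤ length (reverse xs)
  in-range = subst (suc (length xs ∸ suc i) ≤_) (sym (ListP.length-reverse xs))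
    (subst (_≤ length xs) (ℕP.+-∸-assoc 1 i<) (ℕP.m∸n≤m (length xs) i))

nth1-∈ : ∀ {A : Set} (d : A) xs i → 1 ≤ i → i ≤ length xs → nth1 d xs i ∈ xs
nth1-∈ d (x ∷ xs) (suc zero)    _ _         = here refl
nth1-∈ d (x ∷ xs) (suc (suc i)) _ (s≤s i≤) = there (nth1-∈ d xs (suc i) (s≤s z≤n) i≤)

nth1-ext : ∀ (xs ys : List ℕ) → length xs ≡ length ys →
  (∀ i → 1 ≤ i → i ≤ length xs → nth1 0 xs i ≡ nth1 0 ys i) → xs ≡ ys
nth1-ext []       []       _   _     = refl
nth1-ext (x ∷ xs) (y ∷ ys) len same = cong₂ _∷_ (same 1 (s≤s z≤n) (s≤s z≤n))
  (nth1-ext xs ys (ℕP.suc-injective len) (λ i 1≤i i≤ →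
    trans (sym (nth1-cons 0 x xs i 1≤i)) (trans (same (suc i) (s≤s z≤n) (s≤s i≤)) (nth1-cons 0 y ys i 1≤i))))

linked-head : ∀ {x xs} → Linked _<_ (x ∷ xs) → All (x <_) xs
linked-head [-]            = []
linked-head (x<y ∷ linked) = LinkedP.Linked⇒All ℕP.<-trans x<y linked

cons-linked : ∀ {u xs} → All (u <_) xs → Linked _<_ xs → Linked _<_ (u ∷ xs)
cons-linked []          _      = [-]
cons-linked (u<x ∷ _) linked = u<x ∷ linked

linked-nth1 : ∀ xs → Linked _<_ xs → ∀ i → 1 ≤ i → suc i ≤ length xs → nth1 0 xs i < nth1 0 xs (suc i)
linked-nth1 (x ∷ [])     [-]            (suc zero)    _ (s≤s ())
linked-nth1 (x ∷ y ∷ xs) (x<y ∷ _)      (suc zero)    _ _         = x<y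
linked-nth1 (x ∷ y ∷ xs) (_ ∷ linked) (suc (suc i)) _ (s≤s i<) = linked-nth1 (y ∷ xs) linked (suc i) (s≤s z≤n) i<

linked-tabulate : ∀ {R : ℕ → ℕ → Set} (f : ℕ → ℕ) a l →
  (∀ i → a ≤ i → suc i < a + l → R (f i) (f (suc i))) → Linked R (map f (interval a l))
linked-tabulate f a zero          step = []
linked-tabulate f a (suc zero)    step = [-]
linked-tabulate f a (suc (suc l)) step =
  step a ℕP.≤-refl (subst (suc a <_) (sym (ℕP.+-suc a (suc l))) (s≤s (subst (a <_) (sym (ℕP.+-suc a l)) (s≤s (ℕP.m≤m+n a l)))))
  ∷ linked-tabulate f (suc a) (suc l) (λ i a<i si< → step i (ℕP.<⇒≤ a<i) (subst (suc i <_) (sym (ℕP.+-suc a (suc l))) si<))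

linked-interval : ∀ a l → Linked _<_ (interval a l)
linked-interval a l = subst (Linked _<_) (ListP.map-id (interval a l)) (linked-tabulate (λ x → x) a l (λ i _ _ → ℕP.n<1+n i))

Count-++ : ∀ {A : Set} {P : A → Set} {xs ys m m′} → Count P xs m → Count P ys m′ → Count P (xs ++ ys) (m + m′)
Count-++ c[]          c₂ = c₂
Count-++ (cyes p c₁) c₂ = cyes p (Count-++ c₁ c₂)
Count-++ (cno ¬p c₁) c₂ = cno ¬p (Count-++ c₁ c₂)

Count-map⁺ : ∀ {A B : Set} {P : B → Set} (f : A → B) {xs m} → Count (P ∘ f) xs m → Count P (map f xs) m
Count-map⁺ f c[]         = c[]
Count-map⁺ f (cyes p c) = cyes p (Count-map⁺ f c)
Count-map⁺ f (cno ¬p c) = cno ¬p (Count-map⁺ f c)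

Count-map⁻ : ∀ {A B : Set} {P : B → Set} (f : A → B) xs {m} → Count P (map f xs) m → Count (P ∘ f) xs m
Count-map⁻ f []       c[]         = c[]
Count-map⁻ f (x ∷ xs) (cyes p c) = cyes p (Count-map⁻ f xs c)
Count-map⁻ f (x ∷ xs) (cno ¬p c) = cno ¬p (Count-map⁻ f xs c)

Count-⇔ : ∀ {A : Set} {P Q : A → Set} {xs m} → All (λ x → P x ⇔ Q x) xs → Count P xs m → Count Q xs m
Count-⇔ []          c[]         = c[]
Count-⇔ (P⇔Q ∷ hs) (cyes p c) = cyes (Equivalence.to P⇔Q p) (Count-⇔ hs c)
Count-⇔ (P⇔Q ∷ hs) (cno ¬p c) = cno (λ q → ¬p (Equivalence.from P⇔Q q)) (Count-⇔ hs c)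

Count-filter : ∀ {A : Set} {P : A → Set} (P? : Decidable P) xs → Count P xs (length (filter P? xs))
Count-filter P? []       = c[]
Count-filter P? (x ∷ xs) with P? x
... | yes p = cyes p (Count-filter P? xs)
... | no ¬p = cno ¬p (Count-filter P? xs)

Count-unique : ∀ {A : Set} {P : A → Set} {xs m m′} → Count P xs m → Count P xs m′ → m ≡ m′
Count-unique c[]         c[]          = refl
Count-unique (cyes p c) (cyes _ c′) = cong suc (Count-unique c c′)
Count-unique (cyes p c) (cno ¬p c′) = ⊥-elim (¬p p)
Count-unique (cno ¬p c) (cyes p c′) = ⊥-elim (¬p p)
Count-unique (cno _ c)  (cno _ c′)  = Count-unique c c′

Count-all : ∀ {A : Set} {P : A → Set} {xs} → All P xs → Count P xs (length xs)
Count-all []       = c[]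
Count-all (p ∷ ps) = cyes p (Count-all ps)

Count-none : ∀ {A : Set} {P : A → Set} {xs} → All (λ x → ¬ P x) xs → Count P xs 0
Count-none []         = c[]
Count-none (¬p ∷ ps) = cno ¬p (Count-none ps)

Count-lookup : ∀ {A : Set} {P : A → Set} {Q : ℕ → Set} (Q? : Decidable Q) (f : ℕ → A) xs →
  (∀ t → t < length xs → P (f t) ⇔ Q (nth1 0 xs (suc t))) →
  Count P (map f (interval 0 (length xs))) (length (filter Q? xs))
Count-lookup {Q = Q} Q? f xs P⇔Q =
  Count-map⁺ f (Count-⇔ (All-interval 0 (length xs) (λ t _ t< → ⇔-sym (P⇔Q t t<)))
    (Count-map⁻ (λ t → nth1 0 xs (suc t)) (interval 0 (length xs))
      (subst (λ ys → Count Q ys (length (filter Q? xs))) (sym (tabulate-nth1 0 xs)) (Count-filter Q? xs))))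

below : ℕ → List ℕ → ℕ
below y xs = length (filter (_<? y) xs)

above : ℕ → List ℕ → ℕ
above z xs = length (filter (z <?_) xs)

below-++ : ∀ y xs ys → below y (xs ++ ys) ≡ below y xs + below y ys
below-++ y xs ys = trans (cong length (ListP.filter-++ (_<? y) xs ys)) (ListP.length-++ (filter (_<? y) xs))

above-++ : ∀ z xs ys → above z (xs ++ ys) ≡ above z xs + above z ys
above-++ z xs ys = trans (cong length (ListP.filter-++ (z <?_) xs ys)) (ListP.length-++ (filter (z <?_) xs))

below-≤-length : ∀ y xs → below y xs ≤ length xs
below-≤-length y xs = ListP.length-filter (_<? y) xs

below-∷-< : ∀ y x xs → x < y → below y (x ∷ xs) ≡ suc (below y xs)
below-∷-< y x xs x<y = cong length (ListP.filter-accept (_<? y) x<y)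

below-∷-≮ : ∀ y x xs → ¬ x < y → below y (x ∷ xs) ≡ below y xs
below-∷-≮ y x xs x≮y = cong length (ListP.filter-reject (_<? y) x≮y)

below-monotone : ∀ y y′ xs → y ≤ y′ → below y xs ≤ below y′ xs
below-monotone y y′ []       y≤y′ = z≤n
below-monotone y y′ (x ∷ xs) y≤y′ with x <? y | x <? y′
... | yes x<y | yes x<y′ rewrite below-∷-< y x xs x<y | below-∷-< y′ x xs x<y′ = s≤s (below-monotone y y′ xs y≤y′)
... | yes x<y | no  x≮y′ = ⊥-elim (x≮y′ (ℕP.<-≤-trans x<y y≤y′))
... | no  x≮y | yes x<y′ rewrite below-∷-≮ y x xs x≮y | below-∷-< y′ x xs x<y′ =
  ℕP.m≤n⇒m≤1+n (below-monotone y y′ xs y≤y′)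
... | no  x≮y | no  x≮y′ rewrite below-∷-≮ y x xs x≮y | below-∷-≮ y′ x xs x≮y′ = below-monotone y y′ xs y≤y′

below-strict : ∀ x x′ xs → x ∈ xs → x < x′ → suc (below x xs) ≤ below x′ xs
below-strict x x′ (a ∷ xs) (here refl) x<x′
  rewrite below-∷-≮ x x xs (ℕP.<-irrefl refl) | below-∷-< x′ x xs x<x′ = s≤s (below-monotone x x′ xs (ℕP.<⇒≤ x<x′))
below-strict x x′ (a ∷ xs) (there x∈) x<x′ with a <? x | a <? x′
... | yes a<x | yes a<x′ rewrite below-∷-< x a xs a<x | below-∷-< x′ a xs a<x′ = s≤s (below-strict x x′ xs x∈ x<x′)
... | yes a<x | no  a≮x′ = ⊥-elim (a≮x′ (ℕP.<-trans a<x x<x′))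
... | no  a≮x | yes a<x′ rewrite below-∷-≮ x a xs a≮x | below-∷-< x′ a xs a<x′ = ℕP.m≤n⇒m≤1+n (below-strict x x′ xs x∈ x<x′)
... | no  a≮x | no  a≮x′ rewrite below-∷-≮ x a xs a≮x | below-∷-≮ x′ a xs a≮x′ = below-strict x x′ xs x∈ x<x′

rank-injective : ∀ (A B : List ℕ) → (∀ t → below t A ≡ below t B) →
  ∀ x x′ → x ∈ A → x′ ∈ B → below x A ≡ below x′ B → x ≡ x′
rank-injective A B same x x′ x∈A x′∈B rank≡ with ℕP.<-cmp x x′
... | tri≈ _ x≡x′ _ = x≡x′
... | tri< x<x′ _ _ = ⊥-elim (ℕP.<-irrefl refl
  (ℕP.<-≤-trans (subst (_< below x′ A) rank≡ (below-strict x x′ A x∈A x<x′)) (ℕP.≤-reflexive (same x′))))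
... | tri> _ _ x′<x = ⊥-elim (ℕP.<-irrefl refl
  (ℕP.<-≤-trans (subst (_< below x B) (sym rank≡) (below-strict x′ x B x′∈B x′<x)) (ℕP.≤-reflexive (sym (same x)))))

below-sorted : ∀ xs → Linked _<_ xs → ∀ j → 1 ≤ j → j ≤ length xs → below (nth1 0 xs j) xs ≡ j ∸ 1
below-sorted (x ∷ xs) sorted (suc zero) _ _ =
  trans (below-∷-≮ x x xs (ℕP.<-irrefl refl))
        (cong length (ListP.filter-none (_<? x) (All.map (λ x<y y<x → ℕP.<-asym x<y y<x) (linked-head sorted))))
below-sorted (x ∷ xs) sorted (suc (suc j)) _ (s≤s j<) =
  trans (below-∷-< _ x xs (All.lookup (linked-head sorted) (nth1-∈ 0 xs (suc j) (s≤s z≤n) j<)))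
        (cong suc (below-sorted xs (Linked.tail sorted) (suc j) (s≤s z≤n) j<))

above-sorted : ∀ xs → Linked _<_ xs → ∀ i → 1 ≤ i → i ≤ length xs → above (nth1 0 xs i) xs ≡ length xs ∸ i
above-sorted (x ∷ xs) sorted (suc zero) _ _ =
  trans (cong length (ListP.filter-reject (x <?_) (ℕP.<-irrefl refl)))
        (cong length (ListP.filter-all (x <?_) (linked-head sorted)))
above-sorted (x ∷ xs) sorted (suc (suc i)) _ (s≤s i<) =
  trans (cong length (ListP.filter-reject (nth1 0 xs (suc i) <?_)
          (λ y<x → ℕP.<-asym y<x (All.lookup (linked-head sorted) (nth1-∈ 0 xs (suc i) (s≤s z≤n) i<)))))
        (above-sorted xs (Linked.tail sorted) (suc i) (s≤s z≤n) i<)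

above-interval : ∀ z n → above z (interval 1 n) ≡ n ∸ z
above-interval z zero    = sym (ℕP.0∸n≡0 z)
above-interval z (suc n) = begin
  above z (interval 1 (suc n))                            ≡⟨ cong (above z) (trans (cong (interval 1) (ℕP.+-comm 1 n)) (interval-++ 1 n 1)) ⟩
  above z (interval 1 n ++ suc n ∷ [])                    ≡⟨ above-++ z (interval 1 n) (suc n ∷ []) ⟩
  above z (interval 1 n) + above z (suc n ∷ [])           ≡⟨ cong (_+ above z (suc n ∷ [])) (above-interval z n) ⟩
  n ∸ z + above z (suc n ∷ [])                            ≡⟨ last z n ⟩
  suc n ∸ z                                               ∎
  where
  open ≡-Reasoning
  last : ∀ z n → n ∸ z + above z (suc n ∷ []) ≡ suc n ∸ z
  last z n with z <? suc n
  ... | yes z<sn@(s≤s z≤n′) =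
    trans (cong (λ l → n ∸ z + length l) (ListP.filter-accept (z <?_) {xs = []} z<sn))
          (trans (ℕP.+-comm (n ∸ z) 1) (sym (ℕP.+-∸-assoc 1 z≤n′)))
  ... | no  z≮sn =
    trans (cong (λ l → n ∸ z + length l) (ListP.filter-reject (z <?_) {xs = []} z≮sn))
          (trans (ℕP.+-identityʳ _)
                 (trans (ℕP.m≤n⇒m∸n≡0 (ℕP.<⇒≤ (ℕP.≰⇒> (λ z≤n′ → z≮sn (s≤s z≤n′))))) (sym (ℕP.m≤n⇒m∸n≡0 (ℕP.≰⇒> z≮sn)))))

∸-split : ∀ {i r k} → i ≤ r → r ≤ k → (k ∸ r) + (r ∸ i) ≡ k ∸ i
∸-split {i} {r} {k} i≤r r≤k = trans (sym (ℕP.+-∸-assoc (k ∸ r) i≤r)) (cong (_∸ i) (ℕP.m∸n+n≡m r≤k))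

-- Row i of Λ_k concerns position k+1-i of the one-line notation.
row-pos-≥1 : ∀ {k} i → i ≤ k → 1 ≤ suc k ∸ i
row-pos-≥1 i i≤k = subst (1 ≤_) (sym (ℕP.+-∸-assoc 1 i≤k)) (s≤s z≤n)

row-pos-≤k : ∀ {k} i → 1 ≤ i → suc k ∸ i ≤ k
row-pos-≤k {k} (suc i) _ = ℕP.m∸n≤m k i

y-block-row : ∀ {r k} j → r ≤ k → j ≤ k ∸ r → r < suc k ∸ j
y-block-row {r} {k} j r≤k j≤K = subst (r <_) (sym (ℕP.+-∸-assoc 1 j≤k))
  (s≤s (ℕP.m+n≤o⇒m≤o∸n r (subst (_≤ k) (ℕP.+-comm j r) (ℕP.m≤o∸n⇒m+n≤o j r≤k j≤K))))
  where
  j≤k : j ≤ k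
  j≤k = ℕP.≤-trans j≤K (ℕP.m∸n≤m k r)

pred-<-⇔ : ∀ a b → 1 ≤ a → pred a < pred b ⇔ a < b
pred-<-⇔ (suc a) zero    _ = mk⇔ (λ ()) (λ ())
pred-<-⇔ (suc a) (suc b) _ = mk⇔ s≤s ℕP.≤-pred

positive-entry : ∀ n x → 1 ≤ x → x ≤ n → + x ≡ entry (pos (pred x)) × pred x < n
positive-entry n (suc x) _ x≤n = refl , x≤n

negative-entry : ∀ n x → 1 ≤ x → x ≤ n → negℤ (+ x) ≡ entry (neg (pred x)) × pred x < n
negative-entry n (suc x) _ x≤n = refl , x≤n

at-tabulate : ∀ k (g : Fin k → ℕ) (j : Fin k) → at (tabulate g) (suc (toℕ j)) ≡ g j
at-tabulate (suc k) g fzero    = refl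
at-tabulate (suc k) g (fsuc j) = at-tabulate k (λ x → g (fsuc x)) j

RowValue : ℕ → ℕ → (Root → Set) → ℕ → ℕ → Set
RowValue k n S i g = ∃[ m₁ ] ∃[ m₂ ] (Count S (row k n i) m₁ × Count S (topRow k i) m₂ × g ≡ m₁ + m₂)

module OneLine {k n : ℕ} (k<n : k < n) (w : WOG k n) where
  open WOG w

  ol : List ℤ
  ol = oneLine w

  K : ℕ
  K = k ∸ r

  k≤n : k ≤ n
  k≤n = ℕP.<⇒≤ k<n

  Y Z V : ℕ → ℕ
  Y a = nth1 0 ys a
  Z i = nth1 0 zs i
  V l = nth1 0 vs l

  value-range : ∀ {x} → x ∈ ys ++ zs ++ vs → 1 ≤ x × x ≤ n
  value-range x∈ with Equivalence.to (∈-interval 1 n) (subst (_ ∈_) (fromTo-interval 1 n) (PermP.∈-resp-↭ perm x∈))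
  ... | 1≤x , s≤s x≤n = 1≤x , x≤n

  Y-range : ∀ a → 1 ≤ a → a ≤ K → 1 ≤ Y a × Y a ≤ n
  Y-range a 1≤a a≤K = value-range (∈-++⁺ˡ (nth1-∈ 0 ys a 1≤a (subst (a ≤_) (sym len-y) a≤K)))

  Z-range : ∀ i → 1 ≤ i → i ≤ r → 1 ≤ Z i × Z i ≤ n
  Z-range i 1≤i i≤r = value-range (∈-++⁺ʳ ys (∈-++⁺ˡ (nth1-∈ 0 zs i 1≤i (subst (i ≤_) (sym len-z) i≤r))))

  V-range : ∀ t → t < n ∸ k → 1 ≤ V (suc t) × V (suc t) ≤ n
  V-range t t< = value-range (∈-++⁺ʳ ys (∈-++⁺ʳ zs (nth1-∈ 0 vs (suc t) (s≤s z≤n) (subst (suc t ≤_) (sym len-v) t<))))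

  yBlock zBlock vBlock : List ℤ
  yBlock = map +_ ys
  zBlock = map (λ z → negℤ (+ z)) (reverse zs)
  vBlock = map +_ vs

  yBlock-length : length yBlock ≡ K
  yBlock-length = trans (ListP.length-map +_ ys) len-y

  zBlock-length : length zBlock ≡ r
  zBlock-length = trans (ListP.length-map _ (reverse zs)) (trans (ListP.length-reverse zs) len-z)

  k≡blocks : k ≡ length yBlock + length zBlock
  k≡blocks = trans (sym (ℕP.m∸n+n≡m r≤k)) (sym (cong₂ _+_ yBlock-length zBlock-length))

  ol-y : ∀ a → 1 ≤ a → a ≤ K → nth1 0ℤ ol a ≡ + Y a
  ol-y a 1≤a a≤K =
    trans (nth1-++ˡ 0ℤ yBlock _ a 1≤a (subst (a ≤_) (sym yBlock-length) a≤K)) (nth1-map +_ 0 ys a)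

  ol-z : ∀ t → t < r → nth1 0ℤ ol (K + suc t) ≡ negℤ (+ Z (r ∸ t))
  ol-z t t<r = begin
    nth1 0ℤ ol (K + suc t)                                 ≡⟨ cong (λ m → nth1 0ℤ ol (m + suc t)) (sym yBlock-length) ⟩
    nth1 0ℤ ol (length yBlock + suc t)                     ≡⟨ nth1-++ʳ 0ℤ yBlock _ (suc t) (s≤s z≤n) ⟩
    nth1 0ℤ (zBlock ++ vBlock) (suc t)                     ≡⟨ nth1-++ˡ 0ℤ zBlock vBlock (suc t) (s≤s z≤n) (subst (suc t ≤_) (sym zBlock-length) t<r) ⟩
    nth1 0ℤ zBlock (suc t)                                 ≡⟨ nth1-map (λ z → negℤ (+ z)) 0 (reverse zs) (suc t) ⟩
    negℤ (+ nth1 0 (reverse zs) (suc t))                   ≡⟨ cong (λ q → negℤ (+ nth1 0 (reverse zs) (suc q))) t≡ ⟩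
    negℤ (+ nth1 0 (reverse zs) (suc (length zs ∸ (r ∸ t)))) ≡⟨ cong (λ z → negℤ (+ z))
                                                                  (nth1-reverse 0 zs (r ∸ t) (ℕP.m<n⇒0<n∸m t<r)
                                                                     (subst (r ∸ t ≤_) (sym len-z) (ℕP.m∸n≤m r t))) ⟩
    negℤ (+ Z (r ∸ t))                                     ∎
    where
    open ≡-Reasoning
    t≡ : t ≡ length zs ∸ (r ∸ t)
    t≡ = trans (sym (ℕP.m∸[m∸n]≡n (ℕP.<⇒≤ t<r))) (cong (_∸ (r ∸ t)) (sym len-z))

  ol-v : ∀ t → nth1 0ℤ ol (k + suc t) ≡ + V (suc t)
  ol-v t = begin
    nth1 0ℤ ol (k + suc t)                                       ≡⟨ cong (λ m → nth1 0ℤ ol (m + suc t)) k≡blocks ⟩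
    nth1 0ℤ ol (length yBlock + length zBlock + suc t)           ≡⟨ cong (nth1 0ℤ ol) (ℕP.+-assoc (length yBlock) _ (suc t)) ⟩
    nth1 0ℤ ol (length yBlock + (length zBlock + suc t))         ≡⟨ nth1-++ʳ 0ℤ yBlock _ _ (ℕP.≤-trans (s≤s z≤n) (ℕP.m≤n+m (suc t) _)) ⟩
    nth1 0ℤ (zBlock ++ vBlock) (length zBlock + suc t)           ≡⟨ nth1-++ʳ 0ℤ zBlock vBlock (suc t) (s≤s z≤n) ⟩
    nth1 0ℤ vBlock (suc t)                                       ≡⟨ nth1-map +_ 0 vs (suc t) ⟩
    + V (suc t)                                                  ∎
    where open ≡-Reasoning

  yEntry zEntry : ℕ → Signed
  yEntry a = pos (pred (Y a))
  zEntry i = neg (pred (Z i))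

  vEntry : ℕ → Signed
  vEntry t = pos (pred (V (suc t)))

  entry-y : ∀ a → 1 ≤ a → a ≤ K → nth1 0ℤ ol a ≡ entry (yEntry a) × magnitude (yEntry a) < n
  entry-y a 1≤a a≤K with positive-entry n (Y a) (proj₁ (Y-range a 1≤a a≤K)) (proj₂ (Y-range a 1≤a a≤K))
  ... | y≡ , y<n = trans (ol-y a 1≤a a≤K) y≡ , y<n

  entry-z : ∀ t → t < r → nth1 0ℤ ol (K + suc t) ≡ entry (zEntry (r ∸ t)) × magnitude (zEntry (r ∸ t)) < n
  entry-z t t<r with Z-range (r ∸ t) (ℕP.m<n⇒0<n∸m t<r) (ℕP.m∸n≤m r t)
  ... | 1≤z , z≤n′ with negative-entry n (Z (r ∸ t)) 1≤z z≤n′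
  ... | z≡ , z<n = trans (ol-z t t<r) z≡ , z<n

  entry-v : ∀ t → t < n ∸ k → nth1 0ℤ ol (k + suc t) ≡ entry (vEntry t) × magnitude (vEntry t) < n
  entry-v t t< with positive-entry n (V (suc t)) (proj₁ (V-range t t<)) (proj₂ (V-range t t<))
  ... | v≡ , v<n = trans (ol-v t) v≡ , v<n

  -- The (j+1)-st part of γ(w), unfolded to the case distinction defining it
  -- (the right-hand side is the body of gammaOf, found by unification).
  gamma-unfold : (j : Fin k) → at (gammaOf w) (suc (toℕ j)) ≡ _
  gamma-unfold j = at-tabulate k _ j

  gamma-z : ∀ i → 1 ≤ i → i ≤ r → at (gammaOf w) i ≡ (n ∸ k) + (suc n ∸ Z i)
  gamma-z (suc i) _ si≤r =
    subst (λ q → at (gammaOf w) (suc q) ≡ (n ∸ k) + (suc n ∸ Z (suc q))) (toℕ-fromℕ< i<k)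
      (at-fin (fromℕ< i<k) (subst (λ q → suc q ≤ r) (sym (toℕ-fromℕ< i<k)) si≤r))
    where
    i<k : i < k
    i<k = ℕP.<-≤-trans si≤r r≤k
    at-fin : (j : Fin k) → suc (toℕ j) ≤ r → at (gammaOf w) (suc (toℕ j)) ≡ (n ∸ k) + (suc n ∸ Z (suc (toℕ j)))
    at-fin j j<r rewrite gamma-unfold j with suc (toℕ j) ≤? r
    ... | yes _   = refl
    ... | no  j≮r = ⊥-elim (j≮r j<r)

  gamma-y : ∀ i → r < i → i ≤ k → at (gammaOf w) i ≡ below (Y (suc k ∸ i)) vs
  gamma-y (suc i) r<si si≤k =
    subst (λ q → at (gammaOf w) (suc q) ≡ below (Y (suc k ∸ suc q)) vs) (toℕ-fromℕ< si≤k)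
      (at-fin (fromℕ< si≤k) (subst (λ q → r < suc q) (sym (toℕ-fromℕ< si≤k)) r<si))
    where
    at-fin : (j : Fin k) → r < suc (toℕ j) → at (gammaOf w) (suc (toℕ j)) ≡ below (Y (suc k ∸ suc (toℕ j))) vs
    at-fin j r<j rewrite gamma-unfold j with suc (toℕ j) ≤? r
    ... | yes j≤r = ⊥-elim (ℕP.<-irrefl refl (ℕP.<-≤-trans r<j j≤r))
    ... | no  _   = refl

  row-pos-≤n : ∀ i → 1 ≤ i → suc k ∸ i ≤ n
  row-pos-≤n i 1≤i = ℕP.≤-trans (row-pos-≤k i 1≤i) k≤n

  row-pos-≤K : ∀ i → r < i → suc k ∸ i ≤ K
  row-pos-≤K i r<i = ℕP.∸-monoʳ-≤ (suc k) r<i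

  row-pos-z : ∀ i → i ≤ r → suc k ∸ i ≡ K + suc (r ∸ i)
  row-pos-z i i≤r = begin
    suc k ∸ i               ≡⟨ ℕP.+-∸-assoc 1 (ℕP.≤-trans i≤r r≤k) ⟩
    suc (k ∸ i)             ≡⟨ cong suc (sym (∸-split i≤r r≤k)) ⟩
    suc (K + (r ∸ i))       ≡⟨ sym (ℕP.+-suc K (r ∸ i)) ⟩
    K + suc (r ∸ i)         ∎
    where open ≡-Reasoning

  entry-row-z : ∀ i → 1 ≤ i → i ≤ r → nth1 0ℤ ol (suc k ∸ i) ≡ entry (zEntry i) × magnitude (zEntry i) < n
  entry-row-z i 1≤i i≤r =
    subst (λ q → nth1 0ℤ ol (suc k ∸ i) ≡ entry (zEntry q) × magnitude (zEntry q) < n) (ℕP.m∸[m∸n]≡n i≤r)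
      (subst (λ a → nth1 0ℤ ol a ≡ entry (zEntry (r ∸ (r ∸ i))) × magnitude (zEntry (r ∸ (r ∸ i))) < n)
             (sym (row-pos-z i i≤r)) (entry-z (r ∸ i) (ℕP.∸-monoʳ-< 1≤i i≤r)))

  column-≤n : ∀ t → t < n ∸ k → k + suc t ≤ n
  column-≤n t t< = subst (k + suc t ≤_) (ℕP.m+[n∸m]≡n k≤n) (ℕP.+-monoʳ-≤ k t<)

  row-pos<column : ∀ i t → 1 ≤ i → suc k ∸ i < k + suc t
  row-pos<column i t 1≤i =
    ℕP.≤-<-trans (row-pos-≤k i 1≤i) (subst (k <_) (sym (ℕP.+-suc k t)) (s≤s (ℕP.m≤m+n k t)))

  count-columns : (f : ℕ → Root) {Q : ℕ → Set} (Q? : Decidable Q) →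
    (∀ t → t < n ∸ k → Lam w (f (k + suc t)) ⇔ Q (V (suc t))) →
    Count (Lam w) (map f (fromTo (suc k) n)) (length (filter Q? vs))
  count-columns f Q? crit = subst (λ cols → Count (Lam w) cols (length (filter Q? vs))) (sym columns)
    (Count-lookup Q? (f ∘ (λ t → k + suc t)) vs (λ t t< → crit t (subst (t <_) len-v t<)))
    where
    columns : map f (fromTo (suc k) n) ≡ map (f ∘ (λ t → k + suc t)) (interval 0 (length vs))
    columns = begin
      map f (fromTo (suc k) n)                                   ≡⟨ cong (map f) (fromTo-interval (suc k) n) ⟩
      map f (interval (suc k) (n ∸ k))                           ≡⟨ cong (map f) (interval-after k (n ∸ k)) ⟩
      map f (map (λ t → k + suc t) (interval 0 (n ∸ k)))         ≡⟨ sym (ListP.map-∘ (interval 0 (n ∸ k))) ⟩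
      map (f ∘ (λ t → k + suc t)) (interval 0 (n ∸ k))           ≡⟨ cong (λ l → map (f ∘ (λ t → k + suc t)) (interval 0 l)) (sym len-v) ⟩
      map (f ∘ (λ t → k + suc t)) (interval 0 (length vs))      ∎
      where open ≡-Reasoning

  all-columns : (f : ℕ → Root) → (∀ t → t < n ∸ k → Lam w (f (k + suc t))) → Count (Lam w) (map f (fromTo (suc k) n)) (n ∸ k)
  all-columns f lam = subst (Count (Lam w) (map f (fromTo (suc k) n))) (trans (cong length (ListP.filter-all _ (All.universal _ vs))) len-v)
    (count-columns f {Q = λ _ → ⊤} (λ _ → yes tt) (λ t t< → mk⇔ (λ _ → tt) (λ _ → lam t t<)))

  no-columns : (f : ℕ → Root) → (∀ t → t < n ∸ k → ¬ Lam w (f (k + suc t))) → Count (Lam w) (map f (fromTo (suc k) n)) 0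
  no-columns f ¬lam = subst (Count (Lam w) (map f (fromTo (suc k) n))) (cong length (ListP.filter-none _ (All.universal (λ _ ()) vs)))
    (count-columns f {Q = λ _ → ⊥} (λ _ → no (λ ())) (λ t t< → mk⇔ (¬lam t t<) (λ ())))

  count-y-block : (f : ℕ → Root) {Q : ℕ → Set} (Q? : Decidable Q) →
    (∀ t → t < K → Lam w (f (suc t)) ⇔ Q (Y (suc t))) →
    Count (Lam w) (map f (interval 1 K)) (length (filter Q? ys))
  count-y-block f Q? crit = subst (λ l → Count (Lam w) l (length (filter Q? ys))) (sym y-positions)
    (Count-lookup Q? (f ∘ suc) ys (λ t t< → crit t (subst (t <_) len-y t<)))
    where
    y-positions : map f (interval 1 K) ≡ map (f ∘ suc) (interval 0 (length ys))
    y-positions = trans (map-interval-suc f 0 K) (cong (λ l → map (f ∘ suc) (interval 0 l)) (sym len-y))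

  -- A row i > r carries the entry y = y_{k+1-i} > 0 at position A = k+1-i:
  -- e_A - e_c ∈ λ(w) iff v_c < y, while no e_A + e_c and not e_A.
  base-row-y : ∀ i → r < i → i ≤ k → Count (Lam w) (row k n i) (below (Y (suc k ∸ i)) vs + (0 + (0 + 0)))
  base-row-y i r<i i≤k = Count-++ minus-count (Count-++ plus-count (cno short-not c[]))
    where
    1≤i = ℕP.≤-trans (s≤s z≤n) r<i
    A = suc k ∸ i
    1≤A = row-pos-≥1 i i≤k
    eA = entry-y A 1≤A (row-pos-≤K i r<i)
    column : ∀ t → t < n ∸ k → IsPos n (minus A (k + suc t)) × IsPos n (plus A (k + suc t))
    column t t< = (1≤A , row-pos<column i t 1≤i , column-≤n t t<) , (1≤A , row-pos<column i t 1≤i , column-≤n t t<)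
    minus-count : Count (Lam w) (map (minus A) (fromTo (suc k) n)) (below (Y A) vs)
    minus-count = count-columns (minus A) (_<? Y A) λ t t< → let eC = entry-v t t< in
      pred-<-⇔ (V (suc t)) (Y A) (proj₁ (V-range t t<))
      ⇔-∘ Lam-minus w A (k + suc t) (yEntry A) (vEntry t) (proj₁ (column t t<)) (proj₁ eA) (proj₁ eC) (proj₂ eA) (proj₂ eC)
    plus-count : Count (Lam w) (map (plus A) (fromTo (suc k) n)) 0
    plus-count = no-columns (plus A) λ t t< → let eC = entry-v t t< in
      Equivalence.to (Lam-plus w A (k + suc t) (yEntry A) (vEntry t) (proj₂ (column t t<)) (proj₁ eA) (proj₁ eC) (proj₂ eA) (proj₂ eC))
    short-not : ¬ Lam w (short A)
    short-not = Equivalence.to (Lam-short w A (yEntry A) (1≤A , row-pos-≤n i 1≤i) (proj₁ eA) (proj₂ eA))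

  -- In its top row every e_a + e_A has two positive entries, so none is in λ(w).
  top-row-y : ∀ i → r < i → i ≤ k → Count (Lam w) (topRow k i) 0
  top-row-y i r<i i≤k = subst (λ l → Count (Lam w) l 0) (sym (cong (map (λ a → plus a A)) (fromTo-interval 1 (k ∸ i))))
    (Count-map⁺ (λ a → plus a A) (Count-none (All-interval 1 (k ∸ i) λ a 1≤a a< →
      let a<A = subst (a <_) (sym (ℕP.+-∸-assoc 1 i≤k)) a<
          ea  = entry-y a 1≤a (ℕP.≤-trans (ℕP.<⇒≤ a<A) A≤K)
      in Equivalence.to (Lam-plus w a A (yEntry a) (yEntry A) (1≤a , a<A , row-pos-≤n i (ℕP.≤-trans (s≤s z≤n) r<i))
                                  (proj₁ ea) (proj₁ eA) (proj₂ ea) (proj₂ eA)))))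
    where
    A = suc k ∸ i
    A≤K = row-pos-≤K i r<i
    eA = entry-y A (row-pos-≥1 i i≤k) A≤K

  row-y-value : ∀ i → r < i → i ≤ k → RowValue k n (Lam w) i (at (gammaOf w) i)
  row-y-value i r<i i≤k = _ , _ , base-row-y i r<i i≤k , top-row-y i r<i i≤k ,
    trans (gamma-y i r<i i≤k) (sym (trans (ℕP.+-identityʳ _) (ℕP.+-identityʳ _)))

  above-total : ∀ z → above z ys + (above z zs + above z vs) ≡ n ∸ z
  above-total z = begin
    above z ys + (above z zs + above z vs)   ≡⟨ cong (λ m → above z ys + m) (sym (above-++ z zs vs)) ⟩
    above z ys + above z (zs ++ vs)          ≡⟨ sym (above-++ z ys (zs ++ vs)) ⟩
    above z (ys ++ zs ++ vs)                 ≡⟨ PermP.↭-length (PermP.filter-↭ (z <?_) perm) ⟩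
    above z (fromTo 1 n)                     ≡⟨ cong (above z) (fromTo-interval 1 n) ⟩
    above z (interval 1 n)                   ≡⟨ above-interval z n ⟩
    n ∸ z                                    ∎
    where open ≡-Reasoning

  -- A row i ≤ r carries the entry -z, z = z_i, at position A = k+1-i: all
  -- e_A - e_c and e_A lie in λ(w), and e_A + e_c iff z < v_c.
  base-row-z : ∀ i → 1 ≤ i → i ≤ r → Count (Lam w) (row k n i) (n ∸ k + (above (Z i) vs + (1 + 0)))
  base-row-z i 1≤i i≤r = Count-++ minus-count (Count-++ plus-count (cyes short-in c[]))
    where
    A = suc k ∸ i
    1≤A = row-pos-≥1 i (ℕP.≤-trans i≤r r≤k)
    eA = entry-row-z i 1≤i i≤r
    column : ∀ t → t < n ∸ k → IsPos n (minus A (k + suc t)) × IsPos n (plus A (k + suc t))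
    column t t< = (1≤A , row-pos<column i t 1≤i , column-≤n t t<) , (1≤A , row-pos<column i t 1≤i , column-≤n t t<)
    minus-count : Count (Lam w) (map (minus A) (fromTo (suc k) n)) (n ∸ k)
    minus-count = all-columns (minus A) λ t t< → let eC = entry-v t t< in
      Equivalence.from (Lam-minus w A (k + suc t) (zEntry i) (vEntry t) (proj₁ (column t t<)) (proj₁ eA) (proj₁ eC) (proj₂ eA) (proj₂ eC)) tt
    plus-count : Count (Lam w) (map (plus A) (fromTo (suc k) n)) (above (Z i) vs)
    plus-count = count-columns (plus A) (Z i <?_) λ t t< → let eC = entry-v t t< in
      pred-<-⇔ (Z i) (V (suc t)) (proj₁ (Z-range i 1≤i i≤r))
      ⇔-∘ Lam-plus w A (k + suc t) (zEntry i) (vEntry t) (proj₂ (column t t<)) (proj₁ eA) (proj₁ eC) (proj₂ eA) (proj₂ eC)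
    short-in : Lam w (short A)
    short-in = Equivalence.from (Lam-short w A (zEntry i) (1≤A , row-pos-≤n i 1≤i) (proj₁ eA) (proj₂ eA)) tt

  -- In its top row, e_a + e_A ∈ λ(w) iff z < y_a for a in the y-block, and
  -- always for the r - i positions K+1, ..., A-1 of the z-block (entries -z_j).
  top-row-z : ∀ i → 1 ≤ i → i ≤ r → Count (Lam w) (topRow k i) (above (Z i) ys + (r ∸ i))
  top-row-z i 1≤i i≤r = subst (λ l → Count (Lam w) l (above (Z i) ys + (r ∸ i))) (sym top-positions) (Count-++ y-part z-part)
    where
    A = suc k ∸ i
    A≤n = row-pos-≤n i 1≤i
    eA = entry-row-z i 1≤i i≤r
    plusA : ℕ → Root
    plusA a = plus a A
    top-positions : topRow k i ≡ map plusA (interval 1 K) ++ map plusA (interval (1 + K) (r ∸ i))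
    top-positions = begin
      map plusA (fromTo 1 (k ∸ i))                       ≡⟨ cong (map plusA) (fromTo-interval 1 (k ∸ i)) ⟩
      map plusA (interval 1 (k ∸ i))                     ≡⟨ cong (λ l → map plusA (interval 1 l)) (sym (∸-split i≤r r≤k)) ⟩
      map plusA (interval 1 (K + (r ∸ i)))               ≡⟨ cong (map plusA) (interval-++ 1 K (r ∸ i)) ⟩
      map plusA (interval 1 K ++ interval (1 + K) (r ∸ i)) ≡⟨ ListP.map-++ plusA (interval 1 K) (interval (1 + K) (r ∸ i)) ⟩
      map plusA (interval 1 K) ++ map plusA (interval (1 + K) (r ∸ i)) ∎
      where open ≡-Reasoning
    y-part : Count (Lam w) (map plusA (interval 1 K)) (above (Z i) ys)
    y-part = count-y-block plusA (Z i <?_) λ t t<K → let ea = entry-y (suc t) (s≤s z≤n) t<K in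
      pred-<-⇔ (Z i) (Y (suc t)) (proj₁ (Z-range i 1≤i i≤r))
      ⇔-∘ Lam-plus w (suc t) A (yEntry (suc t)) (zEntry i)
                   (s≤s z≤n , ℕP.≤-<-trans t<K (subst (K <_) (sym (row-pos-z i i≤r)) (ℕP.m<m+n K (s≤s z≤n))) , A≤n)
                   (proj₁ ea) (proj₁ eA) (proj₂ ea) (proj₂ eA)
    z-part : Count (Lam w) (map plusA (interval (1 + K) (r ∸ i))) (r ∸ i)
    z-part = subst₂ (Count (Lam w)) (sym (cong (map plusA) (interval-after K (r ∸ i)))) (length-interval 0 (r ∸ i))
      (Count-map⁺ plusA (Count-map⁺ (λ t → K + suc t) (Count-all (All-interval 0 (r ∸ i) λ t _ t< →
        let et = entry-z t (ℕP.<-≤-trans t< (ℕP.m∸n≤m r i))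
        in Equivalence.from (Lam-plus w (K + suc t) A (zEntry (r ∸ t)) (zEntry i)
                                      (subst (1 ≤_) (sym (ℕP.+-suc K t)) (s≤s z≤n) ,
                                       subst (K + suc t <_) (sym (row-pos-z i i≤r)) (ℕP.+-monoʳ-< K (s≤s t<)) , A≤n)
                                      (proj₁ et) (proj₁ eA) (proj₂ et) (proj₂ eA)) tt))))

  -- Summing up: with above z zs = r - i (the z's above z_i are z_{i+1}..z_r)
  -- and above-total, the count is (n-k) + (n+1-z) = γ(w)_i.
  row-z-value : ∀ i → 1 ≤ i → i ≤ r → RowValue k n (Lam w) i (at (gammaOf w) i)
  row-z-value i 1≤i i≤r = _ , _ , base-row-z i 1≤i i≤r , top-row-z i 1≤i i≤r , value
    where
    z = Z i
    above-in-zs : above z zs ≡ r ∸ i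
    above-in-zs = trans (above-sorted zs z-inc i 1≤i (subst (i ≤_) (sym len-z) i≤r)) (cong (_∸ i) len-z)
    regroup : ∀ a b c d → a + suc (c + (d + b)) ≡ (a + (b + (1 + 0))) + (c + d)
    regroup = ℕSolver.solve-∀
    value : at (gammaOf w) i ≡ (n ∸ k + (above z vs + (1 + 0))) + (above z ys + (r ∸ i))
    value = begin
      at (gammaOf w) i                                          ≡⟨ gamma-z i 1≤i i≤r ⟩
      n ∸ k + (suc n ∸ z)                                       ≡⟨ cong (λ m → n ∸ k + m) (ℕP.+-∸-assoc 1 (proj₂ (Z-range i 1≤i i≤r))) ⟩
      n ∸ k + suc (n ∸ z)                                       ≡⟨ cong (λ m → n ∸ k + suc m) (sym (above-total z)) ⟩
      n ∸ k + suc (above z ys + (above z zs + above z vs))      ≡⟨ cong (λ m → n ∸ k + suc (above z ys + (m + above z vs))) above-in-zs ⟩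
      n ∸ k + suc (above z ys + ((r ∸ i) + above z vs))         ≡⟨ regroup (n ∸ k) (above z vs) (above z ys) (r ∸ i) ⟩
      (n ∸ k + (above z vs + (1 + 0))) + (above z ys + (r ∸ i)) ∎
      where open ≡-Reasoning

  fk-gamma : FK k n (Lam w) (gammaOf w)
  fk-gamma i 1≤i i≤k with i ≤? r
  ... | yes i≤r = row-z-value i 1≤i i≤r
  ... | no  i≰r = row-y-value i (ℕP.≰⇒> i≰r) i≤k

  gamma-z-large : ∀ i → 1 ≤ i → i ≤ r → n ∸ k < at (gammaOf w) i
  gamma-z-large i 1≤i i≤r = subst (n ∸ k <_) (sym (gamma-z i 1≤i i≤r))
    (subst (_≤ n ∸ k + (suc n ∸ Z i)) (ℕP.+-comm (n ∸ k) 1)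
       (ℕP.+-monoʳ-≤ (n ∸ k) (ℕP.m<n⇒0<n∸m (s≤s (proj₂ (Z-range i 1≤i i≤r))))))

  gamma-y-small : ∀ i → r < i → i ≤ k → at (gammaOf w) i ≤ n ∸ k
  gamma-y-small i r<i i≤k = subst (_≤ n ∸ k) (sym (gamma-y i r<i i≤k))
    (subst (below (Y (suc k ∸ i)) vs ≤_) len-v (below-≤-length (Y (suc k ∸ i)) vs))

  Z-increasing : ∀ i → 1 ≤ i → suc i ≤ r → Z i < Z (suc i)
  Z-increasing i 1≤i si≤r = linked-nth1 zs z-inc i 1≤i (subst (suc i ≤_) (sym len-z) si≤r)

  gamma-antitone : ∀ i → 1 ≤ i → i < k → at (gammaOf w) (suc i) ≤ at (gammaOf w) i
  gamma-antitone i 1≤i i<k with suc i ≤? r | i ≤? r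
  ... | yes si≤r | _ =
    subst₂ _≤_ (sym (gamma-z (suc i) (s≤s z≤n) si≤r)) (sym (gamma-z i 1≤i (ℕP.<⇒≤ si≤r)))
      (ℕP.+-monoʳ-≤ (n ∸ k) (ℕP.∸-monoʳ-≤ (suc n) (ℕP.<⇒≤ (Z-increasing i 1≤i si≤r))))
  ... | no si≰r | yes i≤r = ℕP.<⇒≤ (ℕP.≤-<-trans (gamma-y-small (suc i) (ℕP.≰⇒> si≰r) i<k) (gamma-z-large i 1≤i i≤r))
  ... | no _    | no i≰r =
    subst₂ _≤_ (sym (gamma-y (suc i) (ℕP.<-trans r<i (ℕP.n<1+n i)) i<k)) (sym (gamma-y i r<i (ℕP.<⇒≤ i<k)))
      (below-monotone _ _ vs (ℕP.<⇒≤ y<y))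
    where
    r<i = ℕP.≰⇒> i≰r
    ki≤K : suc (k ∸ i) ≤ K
    ki≤K = subst (_≤ K) (ℕP.+-∸-assoc 1 (ℕP.<⇒≤ i<k)) (row-pos-≤K i r<i)
    y<y : Y (k ∸ i) < Y (suc k ∸ i)
    y<y = subst (λ q → Y (k ∸ i) < Y q) (sym (ℕP.+-∸-assoc 1 (ℕP.<⇒≤ i<k)))
      (linked-nth1 ys y-inc (k ∸ i) (ℕP.m<n⇒0<n∸m i<k) (subst (suc (k ∸ i) ≤_) (sym len-y) ki≤K))

  gamma-bounded : ∀ i → 1 ≤ i → i ≤ k → at (gammaOf w) i ≤ 2 * n ∸ k
  gamma-bounded i 1≤i i≤k with i ≤? r
  ... | yes i≤r = subst (_≤ 2 * n ∸ k) (sym (gamma-z i 1≤i i≤r))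
      (subst (n ∸ k + (suc n ∸ Z i) ≤_) two-n (ℕP.+-monoʳ-≤ (n ∸ k) (suc-∸ (Z i) (proj₁ (Z-range i 1≤i i≤r)))))
    where
    suc-∸ : ∀ z → 1 ≤ z → suc n ∸ z ≤ n
    suc-∸ (suc z) _ = ℕP.m∸n≤m n z
    two-n : n ∸ k + n ≡ 2 * n ∸ k
    two-n = trans (sym (ℕP.+-∸-comm n k≤n)) (cong (λ m → (n + m) ∸ k) (sym (ℕP.+-identityʳ n)))
  ... | no i≰r = ℕP.≤-trans (gamma-y-small i (ℕP.≰⇒> i≰r) i≤k)
      (ℕP.∸-monoˡ-≤ k (subst (n ≤_) (cong (λ m → n + m) (sym (ℕP.+-identityʳ n))) (ℕP.m≤m+n n n)))

  gamma-strict : ∀ i → 1 ≤ i → i < k → n ∸ k < at (gammaOf w) i → at (gammaOf w) (suc i) < at (gammaOf w) i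
  gamma-strict i 1≤i i<k large with i ≤? r
  ... | no i≰r = ⊥-elim (ℕP.<-irrefl refl (ℕP.<-≤-trans large (gamma-y-small i (ℕP.≰⇒> i≰r) (ℕP.<⇒≤ i<k))))
  ... | yes i≤r with suc i ≤? r
  ...   | yes si≤r = subst₂ _<_ (sym (gamma-z (suc i) (s≤s z≤n) si≤r)) (sym (gamma-z i 1≤i i≤r))
          (ℕP.+-monoʳ-< (n ∸ k) (ℕP.∸-monoʳ-< (Z-increasing i 1≤i si≤r) (ℕP.m≤n⇒m≤1+n (proj₂ (Z-range (suc i) (s≤s z≤n) si≤r)))))
  ...   | no si≰r  = ℕP.≤-<-trans (gamma-y-small (suc i) (ℕP.≰⇒> si≰r) i<k) large

  gamma-in-P : InP k n (gammaOf w)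
  gamma-in-P = gamma-antitone , gamma-bounded , gamma-strict

  -- The rank of y_j among ys ++ vs is recorded by γ(w): it is
  -- (j - 1) + γ(w)_{k+1-j}.
  rank-y : ∀ j → 1 ≤ j → j ≤ K → below (Y j) (ys ++ vs) ≡ (j ∸ 1) + at (gammaOf w) (suc k ∸ j)
  rank-y j 1≤j j≤K = trans (below-++ _ ys vs) (cong₂ _+_ (below-sorted ys y-inc j 1≤j (subst (j ≤_) (sym len-y) j≤K))
      (sym (trans (gamma-y (suc k ∸ j) (y-block-row j r≤k j≤K) (row-pos-≤k j 1≤j))
                  (cong (λ q → below (Y q) vs) (ℕP.m∸[m∸n]≡n (ℕP.m≤n⇒m≤1+n (ℕP.≤-trans j≤K (ℕP.m∸n≤m k r))))))))

_≋_ : ∀ {k} → Vec ℕ k → Vec ℕ k → Set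
_≋_ {k} γ γ′ = ∀ i → 1 ≤ i → i ≤ k → at γ i ≡ at γ′ i

FK-functional : ∀ k n (S : Root → Set) (γ γ′ : Vec ℕ k) → FK k n S γ → FK k n S γ′ → γ ≋ γ′
FK-functional k n S γ γ′ fk fk′ i 1≤i i≤k with fk i 1≤i i≤k | fk′ i 1≤i i≤k
... | _ , _ , c₁ , c₂ , γ≡ | _ , _ , c₁′ , c₂′ , γ′≡ =
  trans γ≡ (trans (cong₂ _+_ (Count-unique c₁ c₁′) (Count-unique c₂ c₂′)) (sym γ′≡))

FK-resp : ∀ k n (S : Root → Set) (γ γ′ : Vec ℕ k) → γ ≋ γ′ → FK k n S γ → FK k n S γ′
FK-resp k n S γ γ′ γ≋γ′ fk i 1≤i i≤k with fk i 1≤i i≤k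
... | m₁ , m₂ , c₁ , c₂ , γ≡ = m₁ , m₂ , c₁ , c₂ , trans (sym (γ≋γ′ i 1≤i i≤k)) γ≡

InP-resp : ∀ k n (γ γ′ : Vec ℕ k) → γ ≋ γ′ → InP k n γ → InP k n γ′
InP-resp k n γ γ′ γ≋γ′ (antitone , bounded , strict) =
  (λ i 1≤i i<k → subst₂ _≤_ (γ≋γ′ (suc i) (s≤s z≤n) i<k) (γ≋γ′ i 1≤i (ℕP.<⇒≤ i<k)) (antitone i 1≤i i<k)) ,
  (λ i 1≤i i≤k → subst (_≤ 2 * n ∸ k) (γ≋γ′ i 1≤i i≤k) (bounded i 1≤i i≤k)) ,
  (λ i 1≤i i<k large → subst₂ _<_ (γ≋γ′ (suc i) (s≤s z≤n) i<k) (γ≋γ′ i 1≤i (ℕP.<⇒≤ i<k))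
     (strict i 1≤i i<k (subst (n ∸ k <_) (sym (γ≋γ′ i 1≤i (ℕP.<⇒≤ i<k))) large)))

∸-cancelˡ : ∀ m a b → a ≤ m → b ≤ m → m ∸ a ≡ m ∸ b → a ≡ b
∸-cancelˡ m a b a≤m b≤m eq = trans (sym (ℕP.m∸[m∸n]≡n a≤m)) (trans (cong (m ∸_) eq) (ℕP.m∸[m∸n]≡n b≤m))

module Injectivity {k n : ℕ} (k<n : k < n) (w w′ : WOG k n) (same : gammaOf w ≋ gammaOf w′) where
  module A = OneLine k<n w
  module B = OneLine k<n w′
  open WOG w
  open WOG w′ renaming (r to r′; ys to ys′; zs to zs′; vs to vs′; r≤k to r′≤k; len-y to len-y′; len-z to len-z′;
                        len-v to len-v′; y-inc to y-inc′; v-inc to v-inc′; perm to perm′)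

  -- r is the number of parts exceeding n - k.
  r≡ : r ≡ r′
  r≡ with ℕP.<-cmp r r′
  ... | tri≈ _ r≡r′ _ = r≡r′
  ... | tri< r<r′ _ _ = ⊥-elim (ℕP.<-irrefl refl (ℕP.<-≤-trans (B.gamma-z-large (suc r) (s≤s z≤n) r<r′)
          (subst (_≤ n ∸ k) (same (suc r) (s≤s z≤n) (ℕP.≤-trans r<r′ r′≤k)) (A.gamma-y-small (suc r) (ℕP.n<1+n r) (ℕP.≤-trans r<r′ r′≤k)))))
  ... | tri> _ _ r′<r = ⊥-elim (ℕP.<-irrefl refl (ℕP.<-≤-trans (A.gamma-z-large (suc r′) (s≤s z≤n) r′<r)
          (subst (_≤ n ∸ k) (sym (same (suc r′) (s≤s z≤n) (ℕP.≤-trans r′<r r≤k))) (B.gamma-y-small (suc r′) (ℕP.n<1+n r′) (ℕP.≤-trans r′<r r≤k)))))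

  -- z_i is read off from γ_i = (n - k) + (n + 1 - z_i).
  zs≡ : zs ≡ zs′
  zs≡ = nth1-ext zs zs′ (trans len-z (trans r≡ (sym len-z′))) λ i 1≤i i≤ →
    let i≤r  = subst (i ≤_) len-z i≤
        i≤r′ = subst (i ≤_) r≡ i≤r
    in ∸-cancelˡ (suc n) _ _ (ℕP.m≤n⇒m≤1+n (proj₂ (A.Z-range i 1≤i i≤r))) (ℕP.m≤n⇒m≤1+n (proj₂ (B.Z-range i 1≤i i≤r′)))
         (ℕP.+-cancelˡ-≡ (n ∸ k) _ _ (trans (sym (A.gamma-z i 1≤i i≤r)) (trans (same i 1≤i (ℕP.≤-trans i≤r r≤k)) (B.gamma-z i 1≤i i≤r′))))

  -- Both words permute 1..n and share zs, so ys ++ vs and ys′ ++ vs′ have the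
  -- same counting function.
  below-rest : ∀ t → below t (ys ++ vs) ≡ below t (ys′ ++ vs′)
  below-rest t = ℕP.+-cancelˡ-≡ (below t zs) _ _ (begin
    below t zs + below t (ys ++ vs)                     ≡⟨ cong (λ m → below t zs + m) (below-++ t ys vs) ⟩
    below t zs + (below t ys + below t vs)              ≡⟨ swap-front (below t zs) (below t ys) (below t vs) ⟩
    below t ys + (below t zs + below t vs)              ≡⟨ cong (λ m → below t ys + m) (sym (below-++ t zs vs)) ⟩
    below t ys + below t (zs ++ vs)                     ≡⟨ sym (below-++ t ys (zs ++ vs)) ⟩
    below t (ys ++ zs ++ vs)                            ≡⟨ PermP.↭-length (PermP.filter-↭ (_<? t) (↭-trans perm (↭-sym perm′))) ⟩
    below t (ys′ ++ zs′ ++ vs′)                         ≡⟨ below-++ t ys′ (zs′ ++ vs′) ⟩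
    below t ys′ + below t (zs′ ++ vs′)                  ≡⟨ cong (λ m → below t ys′ + m) (below-++ t zs′ vs′) ⟩
    below t ys′ + (below t zs′ + below t vs′)           ≡⟨ swap-front (below t ys′) (below t zs′) (below t vs′) ⟩
    below t zs′ + (below t ys′ + below t vs′)           ≡⟨ cong₂ (λ l m → below t l + m) (sym zs≡) (sym (below-++ t ys′ vs′)) ⟩
    below t zs + below t (ys′ ++ vs′)                   ∎)
    where
    open ≡-Reasoning
    swap-front : ∀ a b c → a + (b + c) ≡ b + (a + c)
    swap-front = ℕSolver.solve-∀

  -- y_j is the element of ys ++ vs of rank (j - 1) + γ_{k+1-j}.
  ys≡ : ys ≡ ys′
  ys≡ = nth1-ext ys ys′ (trans len-y (trans K≡ (sym len-y′))) λ j 1≤j j≤ →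
    let j≤K  = subst (j ≤_) len-y j≤
        j≤K′ = subst (j ≤_) K≡ j≤K
    in rank-injective (ys ++ vs) (ys′ ++ vs′) below-rest _ _
         (∈-++⁺ˡ (nth1-∈ 0 ys j 1≤j j≤)) (∈-++⁺ˡ (nth1-∈ 0 ys′ j 1≤j (subst (j ≤_) (sym len-y′) j≤K′)))
         (trans (A.rank-y j 1≤j j≤K)
           (trans (cong (λ m → (j ∸ 1) + m) (same (suc k ∸ j) (row-pos-≥1 j (ℕP.≤-trans j≤K (ℕP.m∸n≤m k r))) (row-pos-≤k j 1≤j)))
                  (sym (B.rank-y j 1≤j j≤K′))))
    where
    K≡ : k ∸ r ≡ k ∸ r′
    K≡ = cong (k ∸_) r≡

  -- Then vs has the same counting function as vs′, and both are sorted.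
  vs≡ : vs ≡ vs′
  vs≡ = nth1-ext vs vs′ (trans len-v (sym len-v′)) λ l 1≤l l≤ →
    let l≤′ = subst (l ≤_) (trans len-v (sym len-v′)) l≤
    in rank-injective vs vs′ below-v _ _ (nth1-∈ 0 vs l 1≤l l≤) (nth1-∈ 0 vs′ l 1≤l l≤′)
         (trans (below-sorted vs v-inc l 1≤l l≤) (sym (below-sorted vs′ v-inc′ l 1≤l l≤′)))
    where
    below-v : ∀ t → below t vs ≡ below t vs′
    below-v t = ℕP.+-cancelˡ-≡ (below t ys) _ _
      (trans (sym (below-++ t ys vs)) (trans (below-rest t) (trans (below-++ t ys′ vs′) (cong (λ l → below t l + below t vs′) (sym ys≡)))))

  oneLine≡ : oneLine w ≡ oneLine w′
  oneLine≡ = cong₂ (λ a b → map +_ a ++ b) ys≡ (cong₂ (λ a b → map (λ z → negℤ (+ z)) (reverse a) ++ map +_ b) zs≡ vs≡)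

gamma-injective : ∀ {k n} → k < n → (w w′ : WOG k n) → gammaOf w ≋ gammaOf w′ → oneLine w ≡ oneLine w′
gamma-injective k<n w w′ same = Injectivity.oneLine≡ k<n w w′ same

-- Distributing the elements of an increasing list U that are not marked by P
-- into two increasing lists ys and vs, so that the j-th element of ys has
-- exactly c_j elements of vs below it, for a prescribed weakly increasing
-- list cs = (c_1, c_2, ...).  Scanning U upwards, a free element becomes the
-- next y when that y needs no further v below it, and a v otherwise (which
-- lowers every outstanding requirement by one).
module Distribute {P : ℕ → Set} (P? : Decidable P) where

  mutual
    distribute : List ℕ → List ℕ → List ℕ × List ℕ
    distribute []      cs = [] , []
    distribute (u ∷ U) cs = distributeAt u U cs (P? u)

    distributeAt : (u : ℕ) → List ℕ → List ℕ → Dec (P u) → List ℕ × List ℕ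
    distributeAt u U cs (yes _) = distribute U cs
    distributeAt u U cs (no _)  = place u U cs

    place : ℕ → List ℕ → List ℕ → List ℕ × List ℕ
    place u U []           = proj₁ (distribute U []) , u ∷ proj₂ (distribute U [])
    place u U (zero ∷ cs)  = u ∷ proj₁ (distribute U cs) , proj₂ (distribute U cs)
    place u U (suc c ∷ cs) = proj₁ (distribute U (map pred (suc c ∷ cs))) , u ∷ proj₂ (distribute U (map pred (suc c ∷ cs)))

  ysOf vsOf : List ℕ → List ℕ → List ℕ
  ysOf U cs = proj₁ (distribute U cs)
  vsOf U cs = proj₂ (distribute U cs)

  mutual
    free : List ℕ → ℕ
    free []      = 0
    free (u ∷ U) = freeAt u U (P? u)

    freeAt : (u : ℕ) → List ℕ → Dec (P u) → ℕ
    freeAt u U (yes _) = free U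
    freeAt u U (no _)  = suc (free U)

  marked+free : ∀ U → length (filter P? U) + free U ≡ length U
  marked+free []      = refl
  marked+free (u ∷ U) with P? u
  ... | yes _ = cong suc (marked+free U)
  ... | no  _ = trans (ℕP.+-suc _ _) (cong suc (marked+free U))

  distribute-↭ : ∀ U cs → ysOf U cs ++ filter P? U ++ vsOf U cs ↭ U
  distribute-↭ []      cs = ↭-refl
  distribute-↭ (u ∷ U) cs with P? u
  ... | yes _ = ↭-trans (PermP.shift u (ysOf U cs) (filter P? U ++ vsOf U cs)) (prep u (distribute-↭ U cs))
  ... | no  _ = placed cs
    where
    to-front : ∀ (a b c : List ℕ) → a ++ b ++ (u ∷ c) ↭ u ∷ (a ++ b ++ c)
    to-front a b c = ↭-trans (↭-reflexive (sym (ListP.++-assoc a b (u ∷ c))))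
      (↭-trans (PermP.shift u (a ++ b) c) (prep u (↭-reflexive (ListP.++-assoc a b c))))
    placed : ∀ cs → proj₁ (place u U cs) ++ filter P? U ++ proj₂ (place u U cs) ↭ u ∷ U
    placed []           = ↭-trans (to-front (ysOf U []) (filter P? U) (vsOf U [])) (prep u (distribute-↭ U []))
    placed (zero ∷ cs)  = prep u (distribute-↭ U cs)
    placed (suc c ∷ cs) = ↭-trans (to-front (ysOf U cs′) (filter P? U) (vsOf U cs′)) (prep u (distribute-↭ U cs′))
      where cs′ = map pred (suc c ∷ cs)

  distribute-All : ∀ {Q : ℕ → Set} U cs → All Q U → All Q (ysOf U cs) × All Q (vsOf U cs)
  distribute-All []      cs []         = [] , []
  distribute-All (u ∷ U) cs (q ∷ qs) with P? u
  ... | yes _ = distribute-All U cs qs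
  ... | no  _ = placed cs
    where
    placed : ∀ cs → All _ (proj₁ (place u U cs)) × All _ (proj₂ (place u U cs))
    placed []           = proj₁ (distribute-All U [] qs) , q ∷ proj₂ (distribute-All U [] qs)
    placed (zero ∷ cs)  = q ∷ proj₁ (distribute-All U cs qs) , proj₂ (distribute-All U cs qs)
    placed (suc c ∷ cs) = proj₁ (distribute-All U cs′ qs) , q ∷ proj₂ (distribute-All U cs′ qs)
      where cs′ = map pred (suc c ∷ cs)

  distribute-sorted : ∀ U cs → Linked _<_ U → Linked _<_ (ysOf U cs) × Linked _<_ (vsOf U cs)
  distribute-sorted []      cs sorted = [] , []
  distribute-sorted (u ∷ U) cs sorted with P? u
  ... | yes _ = distribute-sorted U cs (Linked.tail sorted)
  ... | no  _ = placed cs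
    where
    rest = Linked.tail sorted
    u-below : ∀ cs → All (u <_) (ysOf U cs) × All (u <_) (vsOf U cs)
    u-below cs = distribute-All U cs (linked-head sorted)
    placed : ∀ cs → Linked _<_ (proj₁ (place u U cs)) × Linked _<_ (proj₂ (place u U cs))
    placed []           = proj₁ (distribute-sorted U [] rest) , cons-linked (proj₂ (u-below [])) (proj₂ (distribute-sorted U [] rest))
    placed (zero ∷ cs)  = cons-linked (proj₁ (u-below cs)) (proj₁ (distribute-sorted U cs rest)) , proj₂ (distribute-sorted U cs rest)
    placed (suc c ∷ cs) = proj₁ (distribute-sorted U cs′ rest) , cons-linked (proj₂ (u-below cs′)) (proj₂ (distribute-sorted U cs′ rest))
      where cs′ = map pred (suc c ∷ cs)

  Feasible : List ℕ → List ℕ → Set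
  Feasible U cs = Linked _≤_ cs × All (λ c → c + length cs ≤ free U) cs

  feasible-placed-v : ∀ U c cs → Linked _≤_ (suc c ∷ cs) →
    All (λ c′ → c′ + length (suc c ∷ cs) ≤ suc (free U)) (suc c ∷ cs) → Feasible U (map pred (suc c ∷ cs))
  feasible-placed-v U c cs incr fits = pred-incr incr ,
    AllP.map⁺ (All.zipWith (λ { {suc c′} (fit , _) → subst (λ l → c′ + l ≤ free U) (sym (ListP.length-map pred (suc c ∷ cs))) (ℕP.≤-pred fit)
                              ; {zero} (_ , ()) }) (fits , positive))
    where
    positive : All (1 ≤_) (suc c ∷ cs)
    positive = LinkedP.Linked⇒All ℕP.≤-trans (s≤s z≤n) incr
    pred-incr : ∀ {xs} → Linked _≤_ xs → Linked _≤_ (map pred xs)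
    pred-incr []         = []
    pred-incr [-]        = [-]
    pred-incr (x≤y ∷ l) = ℕP.pred-mono-≤ x≤y ∷ pred-incr l

  feasible-placed-y : ∀ U cs → Linked _≤_ (zero ∷ cs) →
    All (λ c → c + length (zero ∷ cs) ≤ suc (free U)) (zero ∷ cs) → Feasible U cs
  feasible-placed-y U cs incr (_ ∷ fits) =
    Linked.tail incr , All.map (λ {c} fit → ℕP.≤-pred (subst (_≤ suc (free U)) (ℕP.+-suc c (length cs)) fit)) fits

  infeasible-[] : ∀ c (cs : List ℕ) → ¬ (c + suc (length cs) ≤ 0)
  infeasible-[] c cs fit with subst (_≤ 0) (ℕP.+-suc c (length cs)) fit
  ... | ()

  ysOf-length : ∀ U cs → Feasible U cs → length (ysOf U cs) ≡ length cs
  ysOf-length []      []       _                 = refl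
  ysOf-length []      (c ∷ cs) (_ , (fit ∷ _)) = ⊥-elim (infeasible-[] c cs fit)
  ysOf-length (u ∷ U) cs feasible with P? u
  ... | yes _ = ysOf-length U cs feasible
  ... | no  _ = placed cs feasible
    where
    placed : ∀ cs → Linked _≤_ cs × All (λ c → c + length cs ≤ suc (free U)) cs → length (proj₁ (place u U cs)) ≡ length cs
    placed []           _                  = ysOf-length U [] ([] , [])
    placed (zero ∷ cs)  (incr , fits)      = cong suc (ysOf-length U cs (feasible-placed-y U cs incr fits))
    placed (suc c ∷ cs) (incr , fits)      =
      trans (ysOf-length U (map pred (suc c ∷ cs)) (feasible-placed-v U c cs incr fits)) (ListP.length-map pred (suc c ∷ cs))

  ysOf-below : ∀ U cs → Linked _<_ U → Feasible U cs →
    ∀ j → 1 ≤ j → j ≤ length cs → below (nth1 0 (ysOf U cs) j) (vsOf U cs) ≡ nth1 0 cs j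
  ysOf-below []      []       _ _                 (suc j) _ ()
  ysOf-below []      (c ∷ cs) _ (_ , (fit ∷ _)) j       _ _ = ⊥-elim (infeasible-[] c cs fit)
  ysOf-below (u ∷ U) cs sorted feasible with P? u
  ... | yes _ = ysOf-below U cs (Linked.tail sorted) feasible
  ... | no  _ = placed cs feasible
    where
    rest = Linked.tail sorted
    u-below : ∀ cs → All (u <_) (ysOf U cs) × All (u <_) (vsOf U cs)
    u-below cs = distribute-All U cs (linked-head sorted)
    placed : ∀ cs → Linked _≤_ cs × All (λ c → c + length cs ≤ suc (free U)) cs →
      ∀ j → 1 ≤ j → j ≤ length cs → below (nth1 0 (proj₁ (place u U cs)) j) (proj₂ (place u U cs)) ≡ nth1 0 cs j
    placed []           _             (suc j) _ ()
    -- u becomes the first y: nothing in vs lies below it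
    placed (zero ∷ cs)  _             (suc zero) _ _ =
      cong length (ListP.filter-none (_<? u) (All.map (λ u<v v<u → ℕP.<-asym u<v v<u) (proj₂ (u-below cs))))
    placed (zero ∷ cs)  (incr , fits) (suc (suc j)) _ (s≤s j<) =
      ysOf-below U cs rest (feasible-placed-y U cs incr fits) (suc j) (s≤s z≤n) j<
    -- u becomes a v, lying below every y
    placed (suc c ∷ cs) (incr , fits) j 1≤j j≤ = begin
      below y (u ∷ vsOf U cs′)          ≡⟨ below-∷-< y u (vsOf U cs′) u<y ⟩
      suc (below y (vsOf U cs′))        ≡⟨ cong suc (ysOf-below U cs′ rest feasible′ j 1≤j (subst (j ≤_) (sym (ListP.length-map pred (suc c ∷ cs))) j≤)) ⟩
      suc (nth1 0 cs′ j)                ≡⟨ cong suc (nth1-map pred 0 (suc c ∷ cs) j) ⟩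
      suc (pred (nth1 0 (suc c ∷ cs) j)) ≡⟨ ℕP.suc-pred (nth1 0 (suc c ∷ cs) j) ⦃ >-nonZero c-positive ⦄ ⟩
      nth1 0 (suc c ∷ cs) j             ∎
      where
      open ≡-Reasoning
      cs′ = map pred (suc c ∷ cs)
      feasible′ = feasible-placed-v U c cs incr fits
      y = nth1 0 (ysOf U cs′) j
      u<y : u < y
      u<y = All.lookup (proj₁ (u-below cs′)) (nth1-∈ 0 (ysOf U cs′) j 1≤j
              (subst (j ≤_) (sym (trans (ysOf-length U cs′ feasible′) (ListP.length-map pred (suc c ∷ cs)))) j≤))
      c-positive : 0 < nth1 0 (suc c ∷ cs) j
      c-positive = All.lookup (LinkedP.Linked⇒All ℕP.≤-trans (s≤s z≤n) incr) (nth1-∈ 0 (suc c ∷ cs) j 1≤j j≤)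

-- The largest index i ≤ m satisfying Q, or 0 if there is none.
module LastIndex {Q : ℕ → Set} (Q? : Decidable Q) where

  lastIndex : ℕ → ℕ
  lastIndex zero = 0
  lastIndex (suc m) with Q? (suc m)
  ... | yes _ = suc m
  ... | no  _ = lastIndex m

  lastIndex-≤ : ∀ m → lastIndex m ≤ m
  lastIndex-≤ zero = z≤n
  lastIndex-≤ (suc m) with Q? (suc m)
  ... | yes _ = ℕP.≤-refl
  ... | no  _ = ℕP.m≤n⇒m≤1+n (lastIndex-≤ m)

  lastIndex-holds : ∀ m → 1 ≤ lastIndex m → Q (lastIndex m)
  lastIndex-holds (suc m) 1≤ with Q? (suc m)
  ... | yes q = q
  ... | no  _ = lastIndex-holds m 1≤

  lastIndex-last : ∀ m i → lastIndex m < i → i ≤ m → ¬ Q i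
  lastIndex-last zero    i last<i i≤0 = ⊥-elim (ℕP.<-irrefl refl (ℕP.<-≤-trans last<i i≤0))
  lastIndex-last (suc m) i last<i i≤sm with Q? (suc m)
  ... | yes _ = ⊥-elim (ℕP.<-irrefl refl (ℕP.<-≤-trans last<i i≤sm))
  ... | no ¬q with i ℕP.≟ suc m
  ...   | yes refl = ¬q
  ...   | no  i≢sm = lastIndex-last m i last<i (ℕP.≤-pred (ℕP.≤∧≢⇒< i≤sm i≢sm))

antitone-steps : ∀ (g : ℕ → ℕ) k → (∀ i → 1 ≤ i → i < k → g (suc i) ≤ g i) →
  ∀ i j → 1 ≤ i → i ≤ j → j ≤ k → g j ≤ g i
antitone-steps g k step i zero    1≤i i≤0  _    = ⊥-elim (ℕP.<-irrefl refl (ℕP.<-≤-trans 1≤i i≤0))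
antitone-steps g k step i (suc j) 1≤i i≤sj sj≤k with ℕP.m≤n⇒m<n∨m≡n i≤sj
... | inj₂ refl       = ℕP.≤-refl
... | inj₁ (s≤s i≤j) = ℕP.≤-trans (step j (ℕP.≤-trans 1≤i i≤j) sj≤k) (antitone-steps g k step i j 1≤i i≤j (ℕP.<⇒≤ sj≤k))

filter-cong : ∀ {P Q : ℕ → Set} (P? : Decidable P) (Q? : Decidable Q) xs →
  All (λ x → P x ⇔ Q x) xs → filter P? xs ≡ filter Q? xs
filter-cong P? Q? []       []            = refl
filter-cong P? Q? (x ∷ xs) (P⇔Q ∷ rest) with P? x | Q? x
... | yes _ | yes _ = cong (x ∷_) (filter-cong P? Q? xs rest)
... | yes p | no ¬q = ⊥-elim (¬q (Equivalence.to P⇔Q p))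
... | no ¬p | yes q = ⊥-elim (¬p (Equivalence.from P⇔Q q))
... | no _  | no _  = filter-cong P? Q? xs rest

∈-∷-≢ : ∀ {x u : ℕ} {U} → x ∈ u ∷ U → x ≢ u → x ∈ U
∈-∷-≢ (here refl) x≢u = ⊥-elim (x≢u refl)
∈-∷-≢ (there x∈)  _   = x∈

filter-∈-sorted : ∀ U zs → Linked _<_ U → Linked _<_ zs → All (_∈ U) zs → filter (_∈? zs) U ≡ zs
filter-∈-sorted []      []       _        _        _           = refl
filter-∈-sorted []      (z ∷ zs) _        _        (() ∷ _)
filter-∈-sorted (u ∷ U) []       sortedU _        _           = filter-∈-sorted U [] (Linked.tail sortedU) [] []
filter-∈-sorted (u ∷ U) (z ∷ zs) sortedU sortedZ (z∈ ∷ zs∈) with u ℕP.≟ z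
... | yes refl = trans (ListP.filter-accept (_∈? (u ∷ zs)) (here refl)) (cong (u ∷_) (trans
      (filter-cong (_∈? (u ∷ zs)) (_∈? zs) U (All.tabulate λ {x} x∈U →
         mk⇔ (λ x∈ → ∈-∷-≢ x∈ (λ x≡u → ℕP.<-irrefl (sym x≡u) (All.lookup (linked-head sortedU) x∈U))) there))
      (filter-∈-sorted U zs (Linked.tail sortedU) (Linked.tail sortedZ) (All.tabulate λ {x} x∈zs →
         ∈-∷-≢ (All.lookup zs∈ x∈zs) (λ x≡u → ℕP.<-irrefl (sym x≡u) (All.lookup (linked-head sortedZ) x∈zs))))))
... | no u≢z = trans (ListP.filter-reject (_∈? (z ∷ zs)) u∉) (filter-∈-sorted U (z ∷ zs) (Linked.tail sortedU) sortedZ all∈U)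
  where
  z∈U : z ∈ U
  z∈U = ∈-∷-≢ z∈ (λ z≡u → u≢z (sym z≡u))
  u<z : u < z
  u<z = All.lookup (linked-head sortedU) z∈U
  u∉ : ¬ (u ∈ z ∷ zs)
  u∉ (here u≡z) = u≢z u≡z
  u∉ (there u∈) = ℕP.<-irrefl refl (ℕP.<-trans u<z (All.lookup (linked-head sortedZ) u∈))
  all∈U : All (_∈ U) (z ∷ zs)
  all∈U = z∈U ∷ All.tabulate λ {x} x∈zs →
    ∈-∷-≢ (All.lookup zs∈ x∈zs) (λ x≡u → ℕP.<-irrefl (sym x≡u) (ℕP.<-trans u<z (All.lookup (linked-head sortedZ) x∈zs)))

-- Building w from γ ∈ P(n-k, n): r is the number of parts exceeding n - k,
-- z_i = n + 1 - (γ_i - (n - k)) for i ≤ r, and the remaining values are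
-- distributed into ys and vs so that y_j has γ_{k+1-j} of the v's below it.
module Construction {k n : ℕ} (k<n : k < n) (γ : Vec ℕ k) (γ∈P : InP k n γ) where

  g : ℕ → ℕ
  g i = at γ i

  k≤n : k ≤ n
  k≤n = ℕP.<⇒≤ k<n

  g-antitone : ∀ i j → 1 ≤ i → i ≤ j → j ≤ k → g j ≤ g i
  g-antitone = antitone-steps g k (proj₁ γ∈P)

  open LastIndex (λ i → n ∸ k <? g i)

  r : ℕ
  r = lastIndex k

  r≤k : r ≤ k
  r≤k = lastIndex-≤ k

  K : ℕ
  K = k ∸ r

  large : ∀ i → 1 ≤ i → i ≤ r → n ∸ k < g i
  large i 1≤i i≤r = ℕP.<-≤-trans (lastIndex-holds k (ℕP.≤-trans 1≤i i≤r)) (g-antitone i r 1≤i i≤r r≤k)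

  small : ∀ i → r < i → i ≤ k → g i ≤ n ∸ k
  small i r<i i≤k = ℕP.≮⇒≥ (lastIndex-last k i r<i i≤k)

  excess : ℕ → ℕ
  excess i = g i ∸ (n ∸ k)

  excess-≤n : ∀ i → 1 ≤ i → i ≤ k → excess i ≤ n
  excess-≤n i 1≤i i≤k = subst (excess i ≤_) (ℕP.m+n∸m≡n (n ∸ k) n)
    (ℕP.∸-monoˡ-≤ (n ∸ k) (subst (g i ≤_) (sym two-n) (proj₁ (proj₂ γ∈P) i 1≤i i≤k)))
    where
    two-n : n ∸ k + n ≡ 2 * n ∸ k
    two-n = trans (sym (ℕP.+-∸-comm n k≤n)) (cong (λ m → (n + m) ∸ k) (sym (ℕP.+-identityʳ n)))

  zValue : ℕ → ℕ
  zValue i = suc n ∸ excess i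

  zValue-range : ∀ i → 1 ≤ i → i ≤ r → 1 ≤ zValue i × zValue i ≤ n
  zValue-range i 1≤i i≤r =
    ℕP.m<n⇒0<n∸m (s≤s (excess-≤n i 1≤i (ℕP.≤-trans i≤r r≤k))) , suc-∸ (excess i) (ℕP.m<n⇒0<n∸m (large i 1≤i i≤r))
    where
    suc-∸ : ∀ x → 1 ≤ x → suc n ∸ x ≤ n
    suc-∸ (suc x) _ = ℕP.m∸n≤m n x

  -- strictness of the large parts makes the z's increase
  zValue-increasing : ∀ i → 1 ≤ i → suc i ≤ r → zValue i < zValue (suc i)
  zValue-increasing i 1≤i si≤r =
    ℕP.∸-monoʳ-< excess< (ℕP.m≤n⇒m≤1+n (excess-≤n i 1≤i (ℕP.≤-trans (ℕP.<⇒≤ si≤r) r≤k)))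
    where
    g< : g (suc i) < g i
    g< = proj₂ (proj₂ γ∈P) i 1≤i (ℕP.<-≤-trans si≤r r≤k) (large i 1≤i (ℕP.<⇒≤ si≤r))
    excess< : excess (suc i) < excess i
    excess< = ℕP.∸-monoˡ-< g< (ℕP.<⇒≤ (large (suc i) (s≤s z≤n) si≤r))

  zsC : List ℕ
  zsC = map zValue (interval 1 r)

  zsC-length : length zsC ≡ r
  zsC-length = trans (ListP.length-map zValue (interval 1 r)) (length-interval 1 r)

  zsC-nth : ∀ i → 1 ≤ i → i ≤ r → nth1 0 zsC i ≡ zValue i
  zsC-nth (suc i) 1≤i si≤r =
    trans (nth1-map-within zValue (interval 1 r) (suc i) 1≤i (subst (suc i ≤_) (sym (length-interval 1 r)) si≤r))
          (cong zValue (nth1-interval 1 r i si≤r))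

  zsC-sorted : Linked _<_ zsC
  zsC-sorted = linked-tabulate zValue 1 r (λ i 1≤i si< → zValue-increasing i 1≤i (ℕP.≤-pred si<))

  U : List ℕ
  U = interval 1 n

  zsC⊆U : All (_∈ U) zsC
  zsC⊆U = AllP.map⁺ (All-interval 1 r λ i 1≤i i< → let (lo , hi) = zValue-range i 1≤i (ℕP.≤-pred i<) in
    Equivalence.from (∈-interval 1 n) (lo , s≤s hi))

  open Distribute (_∈? zsC)

  zsC-marked : filter (_∈? zsC) U ≡ zsC
  zsC-marked = filter-∈-sorted U zsC (linked-interval 1 n) zsC-sorted zsC⊆U

  free-U : free U ≡ n ∸ r
  free-U = sym (trans (cong (_∸ r) (sym r+free)) (ℕP.m+n∸m≡n r (free U)))
    where
    r+free : r + free U ≡ n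
    r+free = trans (cong (_+ free U) (trans (sym zsC-length) (cong length (sym zsC-marked))))
                         (trans (marked+free U) (length-interval 1 n))

  required : ℕ → ℕ
  required j = g (suc k ∸ j)

  cs : List ℕ
  cs = map required (interval 1 K)

  cs-length : length cs ≡ K
  cs-length = trans (ListP.length-map required (interval 1 K)) (length-interval 1 K)

  cs-feasible : Feasible U cs
  cs-feasible = cs-increasing , AllP.map⁺ (All-interval 1 K λ j 1≤j j< →
    let j≤K = ℕP.≤-pred j< in
    subst (λ q → required j + q ≤ free U) (sym cs-length)
      (subst (required j + K ≤_) (sym free-U) (subst (required j + K ≤_) (∸-split r≤k k≤n)
        (ℕP.+-monoˡ-≤ K (small (suc k ∸ j) (y-block-row j r≤k j≤K) (row-pos-≤k j 1≤j))))))
    where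
    cs-increasing : Linked _≤_ cs
    cs-increasing = linked-tabulate required 1 K λ j 1≤j j< →
      let j<k = ℕP.≤-trans (ℕP.≤-pred j<) (ℕP.m∸n≤m k r) in
      g-antitone (k ∸ j) (suc k ∸ j) (ℕP.m<n⇒0<n∸m j<k)
        (subst (k ∸ j ≤_) (sym (ℕP.+-∸-assoc 1 (ℕP.<⇒≤ j<k))) (ℕP.n≤1+n (k ∸ j))) (row-pos-≤k j 1≤j)

  ysC vsC : List ℕ
  ysC = ysOf U cs
  vsC = vsOf U cs

  permC : ysC ++ zsC ++ vsC ↭ fromTo 1 n
  permC = subst (ysC ++ zsC ++ vsC ↭_) (sym (fromTo-interval 1 n))
    (subst (λ q → ysC ++ q ++ vsC ↭ U) zsC-marked (distribute-↭ U cs))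

  ysC-length : length ysC ≡ K
  ysC-length = trans (ysOf-length U cs cs-feasible) cs-length

  vsC-length : length vsC ≡ n ∸ k
  vsC-length = trans (sym (ℕP.m+n∸m≡n (K + r) (length vsC))) (cong₂ _∸_ (trans (ℕP.+-assoc K r (length vsC)) total) (ℕP.m∸n+n≡m r≤k))
    where
    total : K + (r + length vsC) ≡ n
    total = begin
      K + (r + length vsC)                          ≡⟨ sym (cong₂ _+_ ysC-length (cong (_+ length vsC) zsC-length)) ⟩
      length ysC + (length zsC + length vsC)        ≡⟨ cong (λ m → length ysC + m) (sym (ListP.length-++ zsC)) ⟩
      length ysC + length (zsC ++ vsC)              ≡⟨ sym (ListP.length-++ ysC) ⟩
      length (ysC ++ zsC ++ vsC)                    ≡⟨ PermP.↭-length permC ⟩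
      length (fromTo 1 n)                           ≡⟨ cong length (fromTo-interval 1 n) ⟩
      length (interval 1 n)                         ≡⟨ length-interval 1 n ⟩
      n                                             ∎
      where open ≡-Reasoning

  wγ : WOG k n
  wγ = record
    { r = r ; ys = ysC ; zs = zsC ; vs = vsC ; r≤k = r≤k ; len-y = ysC-length ; len-z = zsC-length ; len-v = vsC-length
    ; y-inc = proj₁ (distribute-sorted U cs (linked-interval 1 n)) ; z-inc = zsC-sorted
    ; v-inc = proj₂ (distribute-sorted U cs (linked-interval 1 n)) ; perm = permC }

  module W = OneLine k<n wγ

  gamma-wγ : gammaOf wγ ≋ γ
  gamma-wγ i 1≤i i≤k with i ≤? r
  ... | yes i≤r = begin
    at (gammaOf wγ) i                      ≡⟨ W.gamma-z i 1≤i i≤r ⟩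
    n ∸ k + (suc n ∸ nth1 0 zsC i)         ≡⟨ cong (λ z → n ∸ k + (suc n ∸ z)) (zsC-nth i 1≤i i≤r) ⟩
    n ∸ k + (suc n ∸ zValue i)             ≡⟨ cong (λ m → n ∸ k + m) (ℕP.m∸[m∸n]≡n (ℕP.m≤n⇒m≤1+n (excess-≤n i 1≤i i≤k))) ⟩
    n ∸ k + excess i                       ≡⟨ ℕP.m+[n∸m]≡n (ℕP.<⇒≤ (large i 1≤i i≤r)) ⟩
    g i                                    ∎
    where open ≡-Reasoning
  ... | no i≰r = begin
    at (gammaOf wγ) i                      ≡⟨ W.gamma-y i r<i i≤k ⟩
    below (nth1 0 ysC j) vsC               ≡⟨ ysOf-below U cs (linked-interval 1 n) cs-feasible j 1≤j (subst (j ≤_) (sym cs-length) j≤K) ⟩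
    nth1 0 cs j                            ≡⟨ nth1-map-within required (interval 1 K) j 1≤j (subst (j ≤_) (sym (length-interval 1 K)) j≤K) ⟩
    required (nth1 0 (interval 1 K) j)     ≡⟨ cong required (nth1-position j 1≤j j≤K) ⟩
    g (suc k ∸ (suc k ∸ i))                ≡⟨ cong g (ℕP.m∸[m∸n]≡n (ℕP.m≤n⇒m≤1+n i≤k)) ⟩
    g i                                    ∎
    where
    open ≡-Reasoning
    r<i = ℕP.≰⇒> i≰r
    j = suc k ∸ i
    1≤j = row-pos-≥1 i i≤k
    j≤K = ℕP.∸-monoʳ-≤ (suc k) r<i
    nth1-position : ∀ j → 1 ≤ j → j ≤ K → nth1 0 (interval 1 K) j ≡ j
    nth1-position (suc t) _ t<K = nth1-interval 1 K t t<K

gamma-surjective : ∀ {k n} → k < n → (γ : Vec ℕ k) → InP k n γ → Σ (WOG k n) (λ w → gammaOf w ≋ γ)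
gamma-surjective k<n γ γ∈P = Construction.wγ k<n γ γ∈P , Construction.gamma-wγ k<n γ γ∈P

Lam-resp-oneLine : ∀ {k n} (w w′ : WOG k n) → oneLine w ≡ oneLine w′ → ∀ ρ → Lam w ρ ⇔ Lam w′ ρ
Lam-resp-oneLine {n = n} w w′ same ρ =
  mk⇔ (λ (isPos , negative) → isPos , subst (λ ol → Negative (act n ol (vec n ρ))) same negative)
      (λ (isPos , negative) → isPos , subst (λ ol → Negative (act n ol (vec n ρ))) (sym same) negative)

proposition1p9 : (k n : ℕ) → 1 ≤ k → k < n →
    ((w : WOG k n) → (γ : Vec ℕ k) → FK k n (Lam w) γ → InP k n γ)
  × ((w w′ : WOG k n) → (γ : Vec ℕ k) → FK k n (Lam w) γ → FK k n (Lam w′) γ →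
       (ρ : Root) → Lam w ρ ⇔ Lam w′ ρ)
  × ((γ : Vec ℕ k) → InP k n γ → Σ (WOG k n) (λ w → FK k n (Lam w) γ))
  × ((w : WOG k n) → FK k n (Lam w) (gammaOf w))
proposition1p9 k n _ k<n = lands-in-P , injective , surjective , fk-gamma
  where
  fk-gamma : (w : WOG k n) → FK k n (Lam w) (gammaOf w)
  fk-gamma w = OneLine.fk-gamma k<n w

  lands-in-P : (w : WOG k n) (γ : Vec ℕ k) → FK k n (Lam w) γ → InP k n γ
  lands-in-P w γ fk = InP-resp k n (gammaOf w) γ (FK-functional k n (Lam w) (gammaOf w) γ (fk-gamma w) fk) (OneLine.gamma-in-P k<n w)

  -- equal images force γ(w) = γ(w′), hence w = w′
  injective : (w w′ : WOG k n) (γ : Vec ℕ k) → FK k n (Lam w) γ → FK k n (Lam w′) γ → (ρ : Root) → Lam w ρ ⇔ Lam w′ ρ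
  injective w w′ γ fk fk′ = Lam-resp-oneLine w w′ (gamma-injective k<n w w′ λ i 1≤i i≤k →
    trans (FK-functional k n (Lam w) (gammaOf w) γ (fk-gamma w) fk i 1≤i i≤k)
          (sym (FK-functional k n (Lam w′) (gammaOf w′) γ (fk-gamma w′) fk′ i 1≤i i≤k)))

  surjective : (γ : Vec ℕ k) → InP k n γ → Σ (WOG k n) (λ w → FK k n (Lam w) γ)
  surjective γ γ∈P with gamma-surjective k<n γ γ∈P
  ... | w , γw≋γ = w , FK-resp k n (Lam w) (gammaOf w) γ γw≋γ (fk-gamma w)
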